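{- Define $r(1)=1$, $r(2)=2$, $r(3)=9$ and, for $n\ge3$, recursively $r(n+1)=\frac{(n+1)(n-1)}{n}\,r(n)^2$. Then the number $f(n)$ of perfect Morse matchings of the $n$-simplex satisfies $f(n)\ge r(n+1)$.
   Context: The faces of the $n$-simplex are all subsets of $\{0,1,\ldots,n\}$, including the empty set. Its Hasse diagram is the graph on these subsets with an edge $\{f,g\}$ whenever $f\subset g$ and $|g|=|f|+1$; this is the graph of the $(n+1)$-dimensional cube. A perfect Morse matching of the $n$-simplex is a perfect matching $\mu$ of this graph that is acyclic: orienting every edge from the larger set to the smaller one, except edges of $\mu$ which are oriented from smaller to larger, yields a directed graph with no directed cycle. -}

module Defs where

open import Data.Nat using (ℕ; zero; suc; _*_; _∸_)
open import Data.Integer using (+_)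
open import Data.Rational using (ℚ; _/_) renaming (_*_ to _*ℚ_)
open import Data.Fin using (Fin)
open import Data.Fin.Subset using (Subset; _⊂_; ∣_∣)
open import Data.Product using (Σ; _×_; ∃; proj₁)
open import Data.Sum using (_⊎_)
open import Relation.Binary.PropositionalEquality using (_≡_; _≢_)
open import Relation.Binary.Construct.Closure.Transitive using (TransClosure)
open import Relation.Nullary using (¬_)

-- Faces of the n-simplex: all subsets of {0,…,n} (including ∅).
Face : ℕ → Set
Face n = Subset (suc n)

Cover : ∀ {n} → Face n → Face n → Set
Cover f g = f ⊂ g × ∣ g ∣ ≡ suc ∣ f ∣

HasseEdge : ∀ {n} → Face n → Face n → Set
HasseEdge f g = Cover f g ⊎ Cover g f

IsPerfectMatching : ∀ {n} → (Face n → Face n) → Set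
IsPerfectMatching {n} μ = (f : Face n) → HasseEdge f (μ f) × μ (μ f) ≡ f

Arc : ∀ {n} → (Face n → Face n) → Face n → Face n → Set
Arc μ x y = (Cover y x × μ x ≢ y) ⊎ (Cover x y × μ x ≡ y)

Acyclic : ∀ {n} → (Face n → Face n) → Set
Acyclic {n} μ = (x : Face n) → ¬ TransClosure (Arc μ) x x

PerfectMorseMatching : ℕ → Set
PerfectMorseMatching n = Σ (Face n → Face n) λ μ → IsPerfectMatching μ × Acyclic μ

Different : ∀ {n} → PerfectMorseMatching n → PerfectMorseMatching n → Set
Different {n} M N = ∃ λ (f : Face n) → proj₁ M f ≢ proj₁ N f

PairwiseDifferent : ∀ {n k} → (Fin k → PerfectMorseMatching n) → Set
PairwiseDifferent {n} {k} g = (i j : Fin k) → i ≢ j → Different (g i) (g j)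

-- The sequence r (r 0 is an unused dummy value).
r : ℕ → ℚ
r zero = + 0 / 1
r (suc zero) = + 1 / 1
r (suc (suc zero)) = + 2 / 1
r (suc (suc (suc zero))) = + 9 / 1
r (suc n@(suc (suc (suc k)))) =
  ((+ (suc n * (n ∸ 1)) / n) *ℚ r n) *ℚ r n

ℕtoℚ : ℕ → ℚ
ℕtoℚ k = + k / 1

{-# OPTIONS --safe #-}
-- Fix a vertex w of the (n+1)-simplex.  Its faces form two copies of the n-simplex, the
-- faces without w and those with w, and perfect Morse matchings μ₀, μ₁ of the n-simplex
-- glue to one of the (n+1)-simplex that never matches along w (pairs a face with one that
-- differs from it in w).  It stays acyclic because no arc leads from the faces without w
-- to those with w.  The glued matching matches along a vertex u ≠ w iff μ₀ or μ₁ does, and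
-- it determines w, μ₀ and μ₁.
--
-- A split family has J matchings per vertex w that never match along w but match along
-- every other vertex.  Gluing, along each vertex, a member for a with a member for b ≠ a
-- turns a split family of the n-simplex into one of the (n+1)-simplex with (n+1)·n·J²
-- members per vertex.  The size c(n) = (n+1)·J thus obeys c(n+1) = ((n+2)n/(n+1))·c(n)²,
-- the recursion of r, so r(n+1) ≤ c(n) propagates.  The recursion starts in dimension 4
-- from the 40824 ordered pairs of the 256 perfect Morse matchings of the 3-simplex that
-- jointly match along every vertex; the matchings in dimensions ≤ 3 are listed explicitly,
-- with height functions certifying acyclicity, and checked by evaluation.
module Submission where

open import Defs
open import Data.Nat using (ℕ; suc)
open import Data.Fin using (Fin)
open import Data.Product using (Σ; _×_)
open import Data.Rational using (_≤_)

open import Data.Bool using (Bool; if_then_else_)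
import Data.Bool.Properties as Bool
open import Data.Empty using (⊥-elim)
open import Data.Fin using (zero; suc; punchIn; punchOut)
open import Data.Fin.Properties using (*↔×; all?)
import Data.Fin.Properties as Fin
open import Data.Fin.Subset using (Subset; inside; outside; _∈_; _⊆_; ∣_∣; _∪_; ⊤)
open import Data.Fin.Subset.Properties using (anySubset?; _⊂?_; x∈p∪q⁻; ∈⊤)
open import Data.Integer using (+_)
import Data.Integer as ℤ
import Data.Integer.Properties as ℤ
open import Data.List as List using (List; []; _∷_; filter; cartesianProduct; allFin)
import Data.List.Properties as List
open import Data.List.Membership.Propositional using () renaming (_∈_ to _∈ₗ_)
open import Data.List.Membership.Propositional.Properties
  using (∈-lookup; ∈-map⁻; ∈-filter⁻; ∈-cartesianProduct⁻)
import Data.List.Relation.Unary.All as All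
import Data.List.Relation.Unary.All.Properties as All
open import Data.List.Relation.Unary.AllPairs using (_∷_; allPairs?)
open import Data.List.Relation.Unary.Unique.Propositional using (Unique)
import Data.List.Relation.Unary.Unique.Propositional.Properties as Unique
open import Data.Nat using (zero; _*_; _+_; _<_; _<?_; _%_; _≡ᵇ_; ⌊_/2⌋; NonZero)
open import Data.Nat.Induction using (<-wellFounded)
import Data.Nat.Properties as ℕ
open import Data.Nat.Tactic.RingSolver using (solve-∀)
open import Data.Product using (_,_; proj₁; proj₂; ∃)
open import Data.Product.Function.NonDependent.Propositional using (_×-↔_)
open import Data.Product.Properties using (,-injective)
open import Data.Product.Relation.Binary.Pointwise.NonDependent using (Pointwise)
open import Data.Rational using (ℚ; _/_; NonNegative; nonNegative; toℚᵘ; _≤?_) renaming (_*_ to _*ℚ_)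
open import Data.Rational.Properties
  using (normalize-nonNeg; nonNeg*nonNeg⇒nonNeg; nonNegative⁻¹; *-monoˡ-≤-nonNeg; *-monoʳ-≤-nonNeg;
         ≤-trans; toℚᵘ-injective; toℚᵘ-homo-*; toℚᵘ-fromℚᵘ; module ≤-Reasoning)
import Data.Rational.Unnormalised as ℚᵘ
import Data.Rational.Unnormalised.Properties as ℚᵘ
open import Data.Sum using (_⊎_; inj₁; inj₂; [_,_])
import Data.Sum as Sum
open import Data.Vec using (Vec; []; _∷_; lookup; insertAt; removeAt; tabulate)
open import Data.Vec.Properties
  using (≡-dec; []=⇒lookup; lookup⇒[]=; lookup∘tabulate; insertAt-lookup; insertAt-punchIn;
         removeAt-insertAt; insertAt-removeAt)
open import Function using (_∘_; _↣_; _↔_; id)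
open import Function.Bundles using (Injection; Equivalence)
open import Function.Construct.Composition using (_↔-∘_)
open import Function.Construct.Identity using (↔-id)
open import Function.Definitions using (Injective)
open import Function.Properties.Inverse using (↔⇒↣)
open import Induction.WellFounded using (WellFounded; Acc; acc; acc⇒asym; module Subrelation)
open import Relation.Binary.Construct.Closure.Transitive as TransClosure using ()
import Relation.Binary.Construct.On as On
open import Relation.Binary.Definitions using (DecidableEquality)
open import Relation.Binary.PropositionalEquality
  using (_≡_; _≢_; _≗_; refl; sym; trans; cong; subst; module ≡-Reasoning)
open import Relation.Nullary using (¬_; Dec; yes; no; ¬?; contradiction)
open import Relation.Nullary.Decidable
  using (decidable-stable; isYes; toWitness; from-yes; _×-dec_; _⊎-dec_; _→-dec_)
open import Relation.Unary using (Decidable)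
import Relation.Nullary.Decidable as Dec

private variable
  k n : ℕ
  I J : Set

-- Well-foundedness of the arcs, rather than Acyclic, is what gluing preserves by induction.
record MorseMatching (n : ℕ) : Set where
  field
    partner           : Face n → Face n
    isPerfectMatching : IsPerfectMatching partner
    wellFounded       : WellFounded (Arc partner)
open MorseMatching public

infix 4 _≈_
_≈_ : MorseMatching n → MorseMatching n → Set
μ ≈ ν = partner μ ≗ partner ν

acyclic : (μ : MorseMatching n) → Acyclic (partner μ)
acyclic μ x cycle =
  acc⇒asym (TransClosure.wellFounded (Arc (partner μ)) (wellFounded μ) x) cycle cycle

toPerfectMorseMatching : MorseMatching n → PerfectMorseMatching n
toPerfectMorseMatching μ = partner μ , isPerfectMatching μ , acyclic μ

infix 4 _≟ˢ_
_≟ˢ_ : DecidableEquality (Subset k)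
_≟ˢ_ = ≡-dec Bool._≟_

different : (μ ν : MorseMatching n) → ¬ μ ≈ ν →
            Different (toPerfectMorseMatching μ) (toPerfectMorseMatching ν)
different μ ν μ≉ν with anySubset? (λ x → ¬? (partner μ x ≟ˢ partner ν x))
... | yes witness = witness
... | no  none    =
  contradiction (λ x → decidable-stable (partner μ x ≟ˢ partner ν x) (λ ne → none (x , ne))) μ≉ν

record Family (n : ℕ) (I : Set) : Set where
  field
    member    : I → MorseMatching n
    injective : Injective _≡_ _≈_ member

reindex : J ↣ I → Family n I → Family n J
reindex f F = record
  { member    = member ∘ Injection.to f
  ; injective = Injection.injective f ∘ injective
  }
  where open Family F

pairwiseDifferent : (F : Family n (Fin k)) →
                    PairwiseDifferent (toPerfectMorseMatching ∘ Family.member F)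
pairwiseDifferent F i j i≢j = different (member i) (member j) (i≢j ∘ injective)
  where open Family F

data PunchInView (w : Fin (suc k)) : Fin (suc k) → Set where
  pivot   : PunchInView w w
  punched : (j : Fin k) → PunchInView w (punchIn w j)

punchInView : (w i : Fin (suc k)) → PunchInView w i
punchInView w i with w Fin.≟ i
... | yes refl = pivot
... | no  w≢i  = subst (PunchInView w) (Fin.punchIn-punchOut w≢i) (punched (punchOut w≢i))

data InsertAtView (w : Fin (suc k)) : Subset (suc k) → Set where
  inserted : (y : Subset k) (b : Bool) → InsertAtView w (insertAt y w b)

insertAtView : (w : Fin (suc k)) (x : Subset (suc k)) → InsertAtView w x
insertAtView w x =
  subst (InsertAtView w) (insertAt-removeAt x w) (inserted (removeAt x w) (lookup x w))

module _ {w : Fin (suc k)} where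

  insertAt-injective : ∀ {p q : Subset k} {b c} → insertAt p w b ≡ insertAt q w c → p ≡ q × b ≡ c
  insertAt-injective {p} {q} {b} {c} eq =
    trans (sym (removeAt-insertAt p w b)) (trans (cong (λ x → removeAt x w) eq) (removeAt-insertAt q w c)) ,
    trans (sym (insertAt-lookup p w b)) (trans (cong (λ x → lookup x w) eq) (insertAt-lookup q w c))

  module _ {p : Subset k} {b : Bool} where

    ∈-insertAt⁺ : ∀ {j} → j ∈ p → punchIn w j ∈ insertAt p w b
    ∈-insertAt⁺ {j} j∈p = lookup⇒[]= _ _ (trans (insertAt-punchIn p w b j) ([]=⇒lookup j∈p))

    ∈-insertAt⁻ : ∀ {j} → punchIn w j ∈ insertAt p w b → j ∈ p
    ∈-insertAt⁻ {j} h = lookup⇒[]= _ _ (trans (sym (insertAt-punchIn p w b j)) ([]=⇒lookup h))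

    pivot∈insertAt⁻ : w ∈ insertAt p w b → b ≡ inside
    pivot∈insertAt⁻ h = trans (sym (insertAt-lookup p w b)) ([]=⇒lookup h)

  pivot∈insertAt : {p : Subset k} → w ∈ insertAt p w inside
  pivot∈insertAt {p} = lookup⇒[]= _ _ (insertAt-lookup p w inside)

  module _ {p q : Subset k} {b : Bool} where

    insertAt-⊆ : p ⊆ q → insertAt p w b ⊆ insertAt q w b
    insertAt-⊆ p⊆q {i} = lift (punchInView w i)
      where
      lift : PunchInView w i → i ∈ insertAt p w b → i ∈ insertAt q w b
      lift pivot       w∈ = subst (λ b → w ∈ insertAt q w b) (sym (pivot∈insertAt⁻ w∈)) pivot∈insertAt
      lift (punched j) j∈ = ∈-insertAt⁺ (p⊆q (∈-insertAt⁻ j∈))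

    insertAt-⊆⁻ : insertAt p w b ⊆ insertAt q w b → p ⊆ q
    insertAt-⊆⁻ h = ∈-insertAt⁻ ∘ h ∘ ∈-insertAt⁺

∣∷∣-cong : ∀ b (p q : Subset k) → ∣ p ∣ ≡ ∣ q ∣ → ∣ b ∷ p ∣ ≡ ∣ b ∷ q ∣
∣∷∣-cong inside  _ _ = cong suc
∣∷∣-cong outside _ _ = id

∣∷∣-suc⁺ : ∀ b (p q : Subset k) → ∣ q ∣ ≡ suc ∣ p ∣ → ∣ b ∷ q ∣ ≡ suc ∣ b ∷ p ∣
∣∷∣-suc⁺ inside  _ _ = cong suc
∣∷∣-suc⁺ outside _ _ = id

∣∷∣-suc⁻ : ∀ b (p q : Subset k) → ∣ b ∷ q ∣ ≡ suc ∣ b ∷ p ∣ → ∣ q ∣ ≡ suc ∣ p ∣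
∣∷∣-suc⁻ inside  _ _ = ℕ.suc-injective
∣∷∣-suc⁻ outside _ _ = id

∣∷∷∣-comm : ∀ a b (p : Subset k) → ∣ a ∷ b ∷ p ∣ ≡ ∣ b ∷ a ∷ p ∣
∣∷∷∣-comm inside  inside  p = refl
∣∷∷∣-comm inside  outside p = refl
∣∷∷∣-comm outside inside  p = refl
∣∷∷∣-comm outside outside p = refl

∣insertAt∣ : (p : Subset k) (w : Fin (suc k)) (b : Bool) → ∣ insertAt p w b ∣ ≡ ∣ b ∷ p ∣
∣insertAt∣ p       zero    b = refl
∣insertAt∣ (a ∷ p) (suc w) b =
  trans (∣∷∣-cong a (insertAt p w b) (b ∷ p) (∣insertAt∣ p w b)) (∣∷∷∣-comm a b p)

module _ {w : Fin (suc (suc n))} {y z : Face n} {b : Bool} where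
  open ≡-Reasoning

  cover-insertAt⁺ : Cover y z → Cover (insertAt y w b) (insertAt z w b)
  cover-insertAt⁺ ((y⊆z , j , j∈z , j∉y) , ∣z∣≡1+∣y∣) =
    (insertAt-⊆ {w = w} y⊆z , punchIn w j , ∈-insertAt⁺ {w = w} j∈z , j∉y ∘ ∈-insertAt⁻ {w = w}) , (begin
      ∣ insertAt z w b ∣  ≡⟨ ∣insertAt∣ z w b ⟩
      ∣ b ∷ z ∣           ≡⟨ ∣∷∣-suc⁺ b y z ∣z∣≡1+∣y∣ ⟩
      suc ∣ b ∷ y ∣       ≡⟨ cong suc (∣insertAt∣ y w b) ⟨
      suc ∣ insertAt y w b ∣ ∎)

  cover-insertAt⁻ : Cover (insertAt y w b) (insertAt z w b) → Cover y z
  cover-insertAt⁻ ((sub , i , i∈z , i∉y) , card) =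
    (insertAt-⊆⁻ {w = w} sub , witness (punchInView w i) i∈z i∉y) , ∣∷∣-suc⁻ b y z (begin
      ∣ b ∷ z ∣               ≡⟨ ∣insertAt∣ z w b ⟨
      ∣ insertAt z w b ∣      ≡⟨ card ⟩
      suc ∣ insertAt y w b ∣  ≡⟨ cong suc (∣insertAt∣ y w b) ⟩
      suc ∣ b ∷ y ∣           ∎)
    where
    witness : ∀ {i} → PunchInView w i → i ∈ insertAt z w b → ¬ i ∈ insertAt y w b →
              ∃ λ j → j ∈ z × ¬ j ∈ y
    witness pivot       w∈z w∉y =
      ⊥-elim (w∉y (subst (λ b → w ∈ insertAt y w b) (sym (pivot∈insertAt⁻ {w = w} w∈z)) pivot∈insertAt))
    witness (punched j) j∈z j∉y = j , ∈-insertAt⁻ {w = w} j∈z , j∉y ∘ ∈-insertAt⁺ {w = w}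

-- Gluing along a vertex

SplitsAlong : MorseMatching n → Fin (suc n) → Set
SplitsAlong μ u = ∀ x → lookup (partner μ x) u ≡ lookup x u

MatchesAlong : MorseMatching n → Fin (suc n) → Set
MatchesAlong μ u = ∃ λ x → lookup (partner μ x) u ≢ lookup x u

module Glue (w : Fin (suc (suc n))) (μ₀ μ₁ : MorseMatching n) where

  layer : Bool → MorseMatching n
  layer outside = μ₀
  layer inside  = μ₁

  glued : Face (suc n) → Face (suc n)
  glued x = insertAt (partner (layer (lookup x w)) (removeAt x w)) w (lookup x w)

  glued-insertAt : ∀ y b → glued (insertAt y w b) ≡ insertAt (partner (layer b) y) w b
  glued-insertAt y b rewrite insertAt-lookup y w b | removeAt-insertAt y w b = refl

  isPerfectMatching-glued : IsPerfectMatching glued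
  isPerfectMatching-glued x with insertAtView w x
  ... | inserted y b = edge , involutive
    where
    open ≡-Reasoning
    ν : Face n → Face n
    ν = partner (layer b)

    edge : HasseEdge (insertAt y w b) (glued (insertAt y w b))
    edge rewrite glued-insertAt y b =
      Sum.map cover-insertAt⁺ cover-insertAt⁺ (proj₁ (isPerfectMatching (layer b) y))

    involutive : glued (glued (insertAt y w b)) ≡ insertAt y w b
    involutive = begin
      glued (glued (insertAt y w b))  ≡⟨ cong glued (glued-insertAt y b) ⟩
      glued (insertAt (ν y) w b)      ≡⟨ glued-insertAt (ν y) b ⟩
      insertAt (ν (ν y)) w b          ≡⟨ cong (λ z → insertAt z w b) (proj₂ (isPerfectMatching (layer b) y)) ⟩
      insertAt y w b                  ∎

  arc-glued⁻ : ∀ {y y' b} → Arc glued (insertAt y w b) (insertAt y' w b) →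
               Arc (partner (layer b)) y y'
  arc-glued⁻ {y} {y'} {b} (inj₁ (cover , ≢)) =
    inj₁ (cover-insertAt⁻ cover , λ eq → ≢ (trans (glued-insertAt y b) (cong (λ z → insertAt z w b) eq)))
  arc-glued⁻ {y} {y'} {b} (inj₂ (cover , eq)) =
    inj₂ (cover-insertAt⁻ cover , proj₁ (insertAt-injective (trans (sym (glued-insertAt y b)) eq)))

  no-arc-inward : ∀ {y y'} → ¬ Arc glued (insertAt y w outside) (insertAt y' w inside)
  no-arc-inward (inj₁ (((sub , _) , _) , _)) with () ← pivot∈insertAt⁻ {w = w} (sub pivot∈insertAt)
  no-arc-inward {y} (inj₂ (_ , eq))
    with () ← proj₂ (insertAt-injective (trans (sym (glued-insertAt y outside)) eq))

  accessible-by-layers : ∀ {x} →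
    (∀ {y b} → Arc glued (insertAt y w b) x → Acc (Arc glued) (insertAt y w b)) → Acc (Arc glued) x
  accessible-by-layers {x} h = acc λ {x'} → by-view (insertAtView w x')
    where
    by-view : ∀ {x'} → InsertAtView w x' → Arc glued x' x → Acc (Arc glued) x'
    by-view (inserted y b) = h

  acc-inside : ∀ {z} → Acc (Arc (partner μ₁)) z → Acc (Arc glued) (insertAt z w inside)
  acc-inside {z} (acc rs) = accessible-by-layers predecessor
    where
    predecessor : ∀ {y b} → Arc glued (insertAt y w b) (insertAt z w inside) →
                  Acc (Arc glued) (insertAt y w b)
    predecessor {b = inside}  arc = acc-inside (rs (arc-glued⁻ arc))
    predecessor {b = outside} arc = ⊥-elim (no-arc-inward arc)

  acc-outside : ∀ {z} → Acc (Arc (partner μ₀)) z → Acc (Arc glued) (insertAt z w outside)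
  acc-outside {z} (acc rs) = accessible-by-layers predecessor
    where
    predecessor : ∀ {y b} → Arc glued (insertAt y w b) (insertAt z w outside) →
                  Acc (Arc glued) (insertAt y w b)
    predecessor {b = outside} arc = acc-outside (rs (arc-glued⁻ arc))
    predecessor {y} {inside}  _   = acc-inside (wellFounded μ₁ y)

  wellFounded-glued : WellFounded (Arc glued)
  wellFounded-glued x with insertAtView w x
  ... | inserted y outside = acc-outside (wellFounded μ₀ y)
  ... | inserted y inside  = acc-inside (wellFounded μ₁ y)

  matching : MorseMatching (suc n)
  matching = record
    { partner           = glued
    ; isPerfectMatching = isPerfectMatching-glued
    ; wellFounded       = wellFounded-glued
    }

  splitsAlong : SplitsAlong matching w
  splitsAlong x = insertAt-lookup _ w _

  matchesAlong : ∀ b {j} → MatchesAlong (layer b) j → MatchesAlong matching (punchIn w j)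
  matchesAlong b {j} (x , moved) = insertAt x w b , λ eq → moved (begin
    lookup (ν x) j                                 ≡⟨ insertAt-punchIn (ν x) w b j ⟨
    lookup (insertAt (ν x) w b) (punchIn w j)      ≡⟨ cong (λ z → lookup z (punchIn w j)) (glued-insertAt x b) ⟨
    lookup (glued (insertAt x w b)) (punchIn w j)  ≡⟨ eq ⟩
    lookup (insertAt x w b) (punchIn w j)          ≡⟨ insertAt-punchIn x w b j ⟩
    lookup x j                                     ∎)
    where
    open ≡-Reasoning
    ν : Face n → Face n
    ν = partner (layer b)

glue : Fin (suc (suc n)) → MorseMatching n → MorseMatching n → MorseMatching (suc n)
glue = Glue.matching

glue-injective : ∀ {w : Fin (suc (suc n))} {μ₀ μ₁ ν₀ ν₁} →
                 glue w μ₀ μ₁ ≈ glue w ν₀ ν₁ → μ₀ ≈ ν₀ × μ₁ ≈ ν₁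
glue-injective {w = w} {μ₀} {μ₁} {ν₀} {ν₁} eq = layerwise outside , layerwise inside
  where
  layerwise : ∀ b y → partner (Glue.layer w μ₀ μ₁ b) y ≡ partner (Glue.layer w ν₀ ν₁ b) y
  layerwise b y = proj₁ (insertAt-injective (begin
    insertAt (partner (Glue.layer w μ₀ μ₁ b) y) w b  ≡⟨ Glue.glued-insertAt w μ₀ μ₁ y b ⟨
    partner (glue w μ₀ μ₁) (insertAt y w b)           ≡⟨ eq (insertAt y w b) ⟩
    partner (glue w ν₀ ν₁) (insertAt y w b)           ≡⟨ Glue.glued-insertAt w ν₀ ν₁ y b ⟩
    insertAt (partner (Glue.layer w ν₀ ν₁ b) y) w b  ∎))
    where open ≡-Reasoning

-- Split families

record SplitFamily (n : ℕ) (I : Set) : Set where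
  field
    member       : Fin (suc n) → I → MorseMatching n
    injective    : ∀ w → Injective _≡_ _≈_ (member w)
    splitsAlong  : ∀ w i → SplitsAlong (member w i) w
    matchesAlong : ∀ w i {u} → u ≢ w → MatchesAlong (member w i) u

  same-direction : ∀ {w i w' i'} → member w i ≈ member w' i' → w ≡ w'
  same-direction {w} {i} {w'} {i'} eq = decidable-stable (w Fin.≟ w') λ w≢w' →
    let x , moved = matchesAlong w' i' w≢w'
    in  moved (trans (cong (λ z → lookup z w) (sym (eq x))) (splitsAlong w i x))

  family : Family n (Fin (suc n) × I)
  family = record
    { member    = λ (w , i) → member w i
    ; injective = λ eq → case≡ (same-direction eq) eq
    }
    where
    case≡ : ∀ {w i w' i'} → w ≡ w' → member w i ≈ member w' i' → (w , i) ≡ (w' , i')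
    case≡ {w} refl eq = cong (w ,_) (injective w eq)

Complementary : MorseMatching n × MorseMatching n → Set
Complementary (μ , ν) = ∀ u → MatchesAlong μ u ⊎ MatchesAlong ν u

record ComplementaryPairs (n : ℕ) (I : Set) : Set where
  field
    pair          : I → MorseMatching n × MorseMatching n
    injective     : Injective _≡_ (Pointwise _≈_ _≈_) pair
    complementary : ∀ i → Complementary (pair i)

reindexPairs : J ↣ I → ComplementaryPairs n I → ComplementaryPairs n J
reindexPairs f P = record
  { pair          = pair ∘ Injection.to f
  ; injective     = Injection.injective f ∘ injective
  ; complementary = complementary ∘ Injection.to f
  }
  where open ComplementaryPairs P

gluePairs : ComplementaryPairs n I → SplitFamily (suc n) I
gluePairs {n} {I} P = record
  { member       = member
  ; injective    = λ w eq → injective (glue-injective eq)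
  ; splitsAlong  = λ w i → Glue.splitsAlong w (proj₁ (pair i)) (proj₂ (pair i))
  ; matchesAlong = matchesAlong
  }
  where
  open ComplementaryPairs P
  member : Fin (suc (suc n)) → I → MorseMatching (suc n)
  member w i = glue w (proj₁ (pair i)) (proj₂ (pair i))

  matchesAlong : ∀ w i {u} → u ≢ w → MatchesAlong (member w i) u
  matchesAlong w i {u} u≢w with punchInView w u
  ... | pivot     = contradiction refl u≢w
  ... | punched j =
    [ Glue.matchesAlong w μ₀ μ₁ outside , Glue.matchesAlong w μ₀ μ₁ inside ] (complementary i j)
    where
    μ₀ μ₁ : MorseMatching n
    μ₀ = proj₁ (pair i)
    μ₁ = proj₂ (pair i)

crossPairs : SplitFamily n I → ComplementaryPairs n (Fin (suc n) × Fin n × I × I)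
crossPairs {n} {I} S = record
  { pair          = pair
  ; injective     = pair-injective
  ; complementary = complementary
  }
  where
  open SplitFamily S
  pair : Fin (suc n) × Fin n × I × I → MorseMatching n × MorseMatching n
  pair (a , b , i , j) = member a i , member (punchIn a b) j

  complementary : ∀ abij → Complementary (pair abij)
  complementary (a , b , i , j) u with u Fin.≟ a
  ... | yes refl = inj₂ (matchesAlong (punchIn u b) j (Fin.punchInᵢ≢i u b ∘ sym))
  ... | no  u≢a  = inj₁ (matchesAlong a i u≢a)

  pair-injective : Injective _≡_ (Pointwise _≈_ _≈_) pair
  pair-injective {a , b , i , j} {a' , b' , i' , j'} (eq₁ , eq₂)
    with refl ← Family.injective family eq₁
    with punchIn≡ , refl ← ,-injective (Family.injective family eq₂)
    with refl ← Fin.punchIn-injective a b b' punchIn≡ = refl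

grow : ∀ {n m} → SplitFamily n (Fin m) → SplitFamily (suc n) (Fin (suc n * (n * (m * m))))
grow {n} {m} S = gluePairs (reindexPairs (↔⇒↣ decompose) (crossPairs S))
  where
  decompose : Fin (suc n * (n * (m * m))) ↔ (Fin (suc n) × Fin n × Fin m × Fin m)
  decompose = (↔-id _ ×-↔ ((↔-id _ ×-↔ *↔×) ↔-∘ *↔×)) ↔-∘ *↔×

splitFamily⇒family : ∀ {m} → SplitFamily n (Fin m) → Family n (Fin (suc n * m))
splitFamily⇒family S = reindex (↔⇒↣ *↔×) (SplitFamily.family S)

lookup-injective : ∀ {A : Set} {xs : List A} → Unique xs →
                   ∀ {i j} → List.lookup xs i ≡ List.lookup xs j → i ≡ j
lookup-injective (_   ∷ _) {zero}  {zero}  _  = refl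
lookup-injective (x∉ ∷ _) {zero}  {suc j} eq = contradiction eq (All.lookup x∉ (∈-lookup j))
lookup-injective (x∉ ∷ _) {suc i} {zero}  eq = contradiction (sym eq) (All.lookup x∉ (∈-lookup i))
lookup-injective (_   ∷ u) {suc i} {suc j} eq = cong suc (lookup-injective u eq)

matchesAlong? : (μ : MorseMatching n) (u : Fin (suc n)) → Dec (MatchesAlong μ u)
matchesAlong? μ u = anySubset? λ x → ¬? (lookup (partner μ x) u Bool.≟ lookup x u)

matchSet : MorseMatching n → Subset (suc n)
matchSet μ = tabulate λ u → isYes (matchesAlong? μ u)

∈-matchSet⁻ : (μ : MorseMatching n) {u : Fin (suc n)} → u ∈ matchSet μ → MatchesAlong μ u
∈-matchSet⁻ μ {u} u∈ = toWitness {a? = matchesAlong? μ u} (Equivalence.from Bool.T-≡ (begin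
  isYes (matchesAlong? μ u)  ≡⟨ lookup∘tabulate (λ u → isYes (matchesAlong? μ u)) u ⟨
  lookup (matchSet μ) u      ≡⟨ []=⇒lookup u∈ ⟩
  inside                     ∎))
  where open ≡-Reasoning

module AllComplementaryPairs {N : ℕ} (F : Family n (Fin N)) where
  open Family F

  Annotated : Set
  Annotated = Fin N × Subset (suc n)

  -- Storing the match set in each list entry lets evaluation compute it once per member
  -- instead of once per candidate pair, which keeps the length of pairs feasible to evaluate.

  annotated : List Annotated
  annotated = List.map (λ i → i , matchSet (member i)) (allFin N)

  covering? : Decidable {A = Annotated × Annotated} λ ((_ , s) , (_ , t)) → s ∪ t ≡ ⊤
  covering? ((_ , s) , (_ , t)) = s ∪ t ≟ˢ ⊤

  pairs : List (Annotated × Annotated)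
  pairs = filter covering? (cartesianProduct annotated annotated)

  ∈-annotated⁻ : ∀ {i s} → (i , s) ∈ₗ annotated → s ≡ matchSet (member i)
  ∈-annotated⁻ i,s∈ with ∈-map⁻ _ i,s∈
  ... | _ , _ , refl = refl

  ∈-pairs⁻ : ∀ {i s j t} → ((i , s) , (j , t)) ∈ₗ pairs →
             s ≡ matchSet (member i) × t ≡ matchSet (member j) × s ∪ t ≡ ⊤
  ∈-pairs⁻ e∈ with ∈-filter⁻ covering? e∈
  ... | e∈product , covers with ∈-cartesianProduct⁻ annotated annotated e∈product
  ...   | i,s∈ , j,t∈ = ∈-annotated⁻ i,s∈ , ∈-annotated⁻ j,t∈ , covers

  unique-pairs : Unique pairs
  unique-pairs = Unique.filter⁺ covering?
    (Unique.cartesianProduct⁺ unique-annotated unique-annotated)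
    where
    unique-annotated : Unique annotated
    unique-annotated = Unique.map⁺ (cong proj₁) (Unique.allFin⁺ N)

  entry≡ : ∀ {i s j t i' s' j' t'} →
           ((i , s) , (j , t)) ∈ₗ pairs → ((i' , s') , (j' , t')) ∈ₗ pairs →
           i ≡ i' → j ≡ j' → ((i , s) , (j , t)) ≡ ((i' , s') , (j' , t'))
  entry≡ e∈ e'∈ refl refl with ∈-pairs⁻ e∈ | ∈-pairs⁻ e'∈
  ... | refl , refl , _ | refl , refl , _ = refl

  pair : Fin (List.length pairs) → MorseMatching n × MorseMatching n
  pair p = member (proj₁ (proj₁ e)) , member (proj₁ (proj₂ e))
    where
    e : Annotated × Annotated
    e = List.lookup pairs p

  ∈-pairs⇒complementary : ∀ {i s j t} → ((i , s) , (j , t)) ∈ₗ pairs →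
                          Complementary (member i , member j)
  ∈-pairs⇒complementary {i} {j = j} e∈ u with ∈-pairs⁻ e∈
  ... | refl , refl , covers =
    Sum.map (∈-matchSet⁻ (member i)) (∈-matchSet⁻ (member j))
      (x∈p∪q⁻ (matchSet (member i)) (matchSet (member j)) (subst (u ∈_) (sym covers) ∈⊤))

  pair-injective : Injective _≡_ (Pointwise _≈_ _≈_) pair
  pair-injective {p} {q} (eq₁ , eq₂) = lookup-injective unique-pairs
    (entry≡ (∈-lookup {xs = pairs} p) (∈-lookup {xs = pairs} q) (injective eq₁) (injective eq₂))

  complementaryPairs : ComplementaryPairs n (Fin (List.length pairs))
  complementaryPairs = record
    { pair          = pair
    ; injective     = pair-injective
    ; complementary = ∈-pairs⇒complementary ∘ ∈-lookup {xs = pairs}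
    }

tabulate-injective : ∀ {A : Set} {m} {f : Fin m → A} → Unique (List.tabulate f) →
                     Injective _≡_ _≡_ f
tabulate-injective {m = suc _} (_   ∷ _) {zero}  {zero}  _  = refl
tabulate-injective {m = suc _} (f∉ ∷ _) {zero}  {suc j} eq = contradiction eq (All.tabulate⁻ f∉ j)
tabulate-injective {m = suc _} (f∉ ∷ _) {suc i} {zero}  eq =
  contradiction (sym eq) (All.tabulate⁻ f∉ i)
tabulate-injective {m = suc _} (_   ∷ u) {suc i} {suc j} eq = cong suc (tabulate-injective u eq)

allSubsets? : ∀ {k} {P : Subset k → Set} → Decidable P → Dec (∀ p → P p)
allSubsets? {zero}  P? = Dec.map′ (λ { P[] [] → P[] }) (λ all → all []) (P? [])
allSubsets? {suc k} P? =
  Dec.map′ (λ { (Pout , Pin) (outside ∷ p) → Pout p ; (Pout , Pin) (inside ∷ p) → Pin p })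
           (λ all → all ∘ (outside ∷_) , all ∘ (inside ∷_))
           (allSubsets? (P? ∘ (outside ∷_)) ×-dec allSubsets? (P? ∘ (inside ∷_)))

cover? : (f g : Face n) → Dec (Cover f g)
cover? f g = (f ⊂? g) ×-dec (∣ g ∣ ℕ.≟ suc ∣ f ∣)

arc? : (μ : Face n → Face n) (x y : Face n) → Dec (Arc μ x y)
arc? μ x y = (cover? y x ×-dec ¬? (μ x ≟ˢ y)) ⊎-dec (cover? x y ×-dec (μ x ≟ˢ y))

isPerfectMatching? : (μ : Face n → Face n) → Dec (IsPerfectMatching μ)
isPerfectMatching? μ =
  allSubsets? λ f → (cover? f (μ f) ⊎-dec cover? (μ f) f) ×-dec (μ (μ f) ≟ˢ f)

IncreasesAlongArcs : (Face n → Face n) → (Face n → ℕ) → Set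
IncreasesAlongArcs μ φ = ∀ x y → Arc μ x y → φ x < φ y

increasesAlongArcs? : (μ : Face n → Face n) (φ : Face n → ℕ) → Dec (IncreasesAlongArcs μ φ)
increasesAlongArcs? μ φ = allSubsets? λ x → allSubsets? λ y → arc? μ x y →-dec (φ x <? φ y)

increasing⇒wellFounded : ∀ {μ : Face n → Face n} {φ} → IncreasesAlongArcs μ φ →
                         WellFounded (Arc μ)
increasing⇒wellFounded {φ = φ} increases =
  Subrelation.wellFounded (increases _ _) (On.wellFounded φ <-wellFounded)

-- A table describes a map on the faces of the n-simplex, a face x being numbered by the
-- binary number encode x (vertex i ↦ bit i): entry encode x of the first list is the number
-- of the partner of x, entry encode x of the second list is a height of x.  Entries missing
-- from a list read as 0.
encode : Subset k → ℕ
encode []      = 0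
encode (b ∷ p) = (if b then 1 else 0) + 2 * encode p

decode : ∀ k → ℕ → Subset k
decode zero    _ = []
decode (suc k) m = (m % 2 ≡ᵇ 1) ∷ decode k ⌊ m /2⌋

_!_ : List ℕ → ℕ → ℕ
[]       ! _     = 0
(x ∷ _)  ! zero  = x
(_ ∷ xs) ! suc i = xs ! i

Table : Set
Table = List ℕ × List ℕ

tablePartner : Table → Face n → Face n
tablePartner {n} (partners , _) x = decode (suc n) (partners ! encode x)

tableHeight : Table → Face n → ℕ
tableHeight (_ , heights) x = heights ! encode x

ValidTable : ℕ → Table → Set
ValidTable n T =
  IsPerfectMatching (tablePartner {n} T) × IncreasesAlongArcs (tablePartner {n} T) (tableHeight T)

validTable? : ∀ n → Decidable (ValidTable n)
validTable? n T =
  isPerfectMatching? (tablePartner T) ×-dec increasesAlongArcs? (tablePartner T) (tableHeight T)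

allSubsets : ∀ k → List (Subset k)
allSubsets zero    = [] ∷ []
allSubsets (suc k) =
  List.map (outside ∷_) (allSubsets k) List.++ List.map (inside ∷_) (allSubsets k)

graph : (Face n → Face n) → List (Face n)
graph {n} μ = List.map μ (allSubsets (suc n))

graphsDistinct? : ∀ n {N} (tables : Vec Table N) →
                  Dec (Unique (List.tabulate (graph ∘ tablePartner {n} ∘ lookup tables)))
graphsDistinct? n tables = allPairs? (λ g h → ¬? (List.≡-dec _≟ˢ_ g h)) _

tableFamily : ∀ {N} (tables : Vec Table N) →
              (∀ i → ValidTable n (lookup tables i)) →
              Unique (List.tabulate (graph ∘ tablePartner {n} ∘ lookup tables)) →
              Family n (Fin N)
tableFamily {n} tables valid distinct = record
  { member    = λ i → record
      { partner           = tablePartner (lookup tables i)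
      ; isPerfectMatching = proj₁ (valid i)
      ; wellFounded       = increasing⇒wellFounded (proj₂ (valid i))
      }
  ; injective = λ eq → tabulate-injective distinct (List.map-cong eq (allSubsets (suc n)))
  }

-- The bound on r

scaledSquare-nonNeg : ∀ c d x .{{_ : NonZero d}} .{{x≥0 : NonNegative x}} →
                      NonNegative ((+ c / d *ℚ x) *ℚ x)
scaledSquare-nonNeg c d x =
  nonNeg*nonNeg⇒nonNeg (+ c / d *ℚ x) {{nonNeg*nonNeg⇒nonNeg (+ c / d) {{normalize-nonNeg c d}} x}} x

r-nonNegative : ∀ n → NonNegative (r n)
r-nonNegative zero                        = _
r-nonNegative (suc zero)                  = _
r-nonNegative (suc (suc zero))            = _
r-nonNegative (suc (suc (suc zero)))      = _
r-nonNegative (suc n@(suc (suc (suc k)))) =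
  scaledSquare-nonNeg (suc n * suc (suc k)) n (r n) {{x≥0 = r-nonNegative n}}

scaledSquareᵘ : ∀ c d a T → c * (a * a) ≡ T * suc d →
                (ℚᵘ.mkℚᵘ (+ c) d ℚᵘ.* ℚᵘ.mkℚᵘ (+ a) 0) ℚᵘ.* ℚᵘ.mkℚᵘ (+ a) 0
                  ℚᵘ.≃ ℚᵘ.mkℚᵘ (+ T) 0
scaledSquareᵘ c d a T eq = ℚᵘ.*≡* (begin
  ((+ c ℤ.* + a) ℤ.* + a) ℤ.* + 1  ≡⟨ ℤ.*-identityʳ _ ⟩
  (+ c ℤ.* + a) ℤ.* + a            ≡⟨ cong (ℤ._* + a) (ℤ.pos-* c a) ⟨
  + (c * a) ℤ.* + a                ≡⟨ ℤ.pos-* (c * a) a ⟨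
  + (c * a * a)                    ≡⟨ cong +_ (trans (ℕ.*-assoc c a a) eq) ⟩
  + (T * suc d)                    ≡⟨ ℤ.pos-* T (suc d) ⟩
  + T ℤ.* + suc d                  ≡⟨ cong (λ m → + T ℤ.* + suc m) (trans (ℕ.*-identityʳ (d * 1)) (ℕ.*-identityʳ d)) ⟨
  + T ℤ.* + suc (d * 1 * 1)        ∎)
  where open ≡-Reasoning

scaledSquare : ∀ c d a T → c * (a * a) ≡ T * suc d →
               (+ c / suc d *ℚ ℕtoℚ a) *ℚ ℕtoℚ a ≡ ℕtoℚ T
scaledSquare c d a T eq = toℚᵘ-injective (begin
  toℚᵘ ((q *ℚ ℕtoℚ a) *ℚ ℕtoℚ a)
    ≈⟨ toℚᵘ-homo-* (q *ℚ ℕtoℚ a) (ℕtoℚ a) ⟩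
  toℚᵘ (q *ℚ ℕtoℚ a) ℚᵘ.* toℚᵘ (ℕtoℚ a)
    ≈⟨ ℚᵘ.*-cong (toℚᵘ-homo-* q (ℕtoℚ a)) ℚᵘ.≃-refl ⟩
  (toℚᵘ q ℚᵘ.* toℚᵘ (ℕtoℚ a)) ℚᵘ.* toℚᵘ (ℕtoℚ a)
    ≈⟨ ℚᵘ.*-cong (ℚᵘ.*-cong (toℚᵘ-fromℚᵘ (ℚᵘ.mkℚᵘ (+ c) d)) a≃) a≃ ⟩
  (ℚᵘ.mkℚᵘ (+ c) d ℚᵘ.* ℚᵘ.mkℚᵘ (+ a) 0) ℚᵘ.* ℚᵘ.mkℚᵘ (+ a) 0
    ≈⟨ scaledSquareᵘ c d a T eq ⟩
  ℚᵘ.mkℚᵘ (+ T) 0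
    ≈⟨ toℚᵘ-fromℚᵘ (ℚᵘ.mkℚᵘ (+ T) 0) ⟨
  toℚᵘ (ℕtoℚ T)
    ∎)
  where
  open ℚᵘ.≃-Reasoning
  q : ℚ
  q = + c / suc d
  a≃ : toℚᵘ (ℕtoℚ a) ℚᵘ.≃ ℚᵘ.mkℚᵘ (+ a) 0
  a≃ = toℚᵘ-fromℚᵘ (ℚᵘ.mkℚᵘ (+ a) 0)

scaledSquare-mono : ∀ c d x y .{{_ : NonNegative x}} → x ≤ y →
                    (+ c / suc d *ℚ x) *ℚ x ≤ (+ c / suc d *ℚ y) *ℚ y
scaledSquare-mono c d x y x≤y = begin
  (q *ℚ x) *ℚ x  ≤⟨ *-monoˡ-≤-nonNeg (q *ℚ x) {{q*x≥0}} x≤y ⟩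
  (q *ℚ x) *ℚ y  ≤⟨ *-monoʳ-≤-nonNeg y {{y≥0}} (*-monoˡ-≤-nonNeg q {{q≥0}} x≤y) ⟩
  (q *ℚ y) *ℚ y  ∎
  where
  open ≤-Reasoning
  q : ℚ
  q = + c / suc d
  q≥0 : NonNegative q
  q≥0 = normalize-nonNeg c (suc d)
  q*x≥0 : NonNegative (q *ℚ x)
  q*x≥0 = nonNeg*nonNeg⇒nonNeg q {{q≥0}} x
  y≥0 : NonNegative y
  y≥0 = nonNegative (≤-trans (nonNegative⁻¹ x) x≤y)

count-recursion : ∀ n m → (4 + n) * (2 + n) * ((3 + n) * m * ((3 + n) * m)) ≡
                         (4 + n) * ((3 + n) * ((2 + n) * (m * m))) * (3 + n)
count-recursion = solve-∀

r-step : ∀ n m → r (3 + n) ≤ ℕtoℚ ((3 + n) * m) →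
         r (4 + n) ≤ ℕtoℚ ((4 + n) * ((3 + n) * ((2 + n) * (m * m))))
r-step n m bound = begin
  r (4 + n)                      ≡⟨⟩
  (q *ℚ r (3 + n)) *ℚ r (3 + n)  ≤⟨ scaledSquare-mono c (2 + n) (r (3 + n)) (ℕtoℚ M) {{r-nonNegative (3 + n)}} bound ⟩
  (q *ℚ ℕtoℚ M) *ℚ ℕtoℚ M        ≡⟨ scaledSquare c (2 + n) M T (count-recursion n m) ⟩
  ℕtoℚ T                         ∎
  where
  open ≤-Reasoning
  c M T : ℕ
  c = (4 + n) * (2 + n)
  M = (3 + n) * m
  T = (4 + n) * ((3 + n) * ((2 + n) * (m * m)))
  q : ℚ
  q = + c / (3 + n)

-- The perfect Morse matchings of the simplices of dimension 0, 1, 2 and 3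

table₀ : Vec Table 1
table₀ =
    (1 ∷ 0 ∷ [] , 0 ∷ 1 ∷ [])
  ∷ []

table₁ : Vec Table 2
table₁ =
    (1 ∷ 0 ∷ 3 ∷ 2 ∷ [] , 1 ∷ 2 ∷ 0 ∷ 1 ∷ [])
  ∷ (2 ∷ 3 ∷ 0 ∷ 1 ∷ [] , 1 ∷ 0 ∷ 2 ∷ 1 ∷ [])
  ∷ []

table₂ : Vec Table 9
table₂ =
    (1 ∷ 0 ∷ 3 ∷ 2 ∷ 5 ∷ 4 ∷ 7 ∷ 6 ∷ [] , 2 ∷ 3 ∷ 1 ∷ 2 ∷ 1 ∷ 2 ∷ 0 ∷ 1 ∷ [])
  ∷ (1 ∷ 0 ∷ 3 ∷ 2 ∷ 6 ∷ 7 ∷ 4 ∷ 5 ∷ [] , 4 ∷ 5 ∷ 3 ∷ 4 ∷ 1 ∷ 0 ∷ 2 ∷ 1 ∷ [])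
  ∷ (1 ∷ 0 ∷ 6 ∷ 7 ∷ 5 ∷ 4 ∷ 2 ∷ 3 ∷ [] , 4 ∷ 5 ∷ 1 ∷ 0 ∷ 3 ∷ 4 ∷ 2 ∷ 1 ∷ [])
  ∷ (2 ∷ 3 ∷ 0 ∷ 1 ∷ 5 ∷ 4 ∷ 7 ∷ 6 ∷ [] , 4 ∷ 3 ∷ 5 ∷ 4 ∷ 1 ∷ 2 ∷ 0 ∷ 1 ∷ [])
  ∷ (2 ∷ 3 ∷ 0 ∷ 1 ∷ 6 ∷ 7 ∷ 4 ∷ 5 ∷ [] , 2 ∷ 1 ∷ 3 ∷ 2 ∷ 1 ∷ 0 ∷ 2 ∷ 1 ∷ [])
  ∷ (2 ∷ 5 ∷ 0 ∷ 7 ∷ 6 ∷ 1 ∷ 4 ∷ 3 ∷ [] , 4 ∷ 1 ∷ 5 ∷ 0 ∷ 3 ∷ 2 ∷ 4 ∷ 1 ∷ [])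
  ∷ (4 ∷ 3 ∷ 6 ∷ 1 ∷ 0 ∷ 7 ∷ 2 ∷ 5 ∷ [] , 4 ∷ 1 ∷ 3 ∷ 2 ∷ 5 ∷ 0 ∷ 4 ∷ 1 ∷ [])
  ∷ (4 ∷ 5 ∷ 3 ∷ 2 ∷ 0 ∷ 1 ∷ 7 ∷ 6 ∷ [] , 4 ∷ 3 ∷ 1 ∷ 2 ∷ 5 ∷ 4 ∷ 0 ∷ 1 ∷ [])
  ∷ (4 ∷ 5 ∷ 6 ∷ 7 ∷ 0 ∷ 1 ∷ 2 ∷ 3 ∷ [] , 2 ∷ 1 ∷ 1 ∷ 0 ∷ 3 ∷ 2 ∷ 2 ∷ 1 ∷ [])
  ∷ []

table₃ : Vec Table 256
table₃ =
    (1 ∷ 0 ∷ 3 ∷ 2 ∷ 5 ∷ 4 ∷ 7 ∷ 6 ∷ 9 ∷ 8 ∷ 11 ∷ 10 ∷ 13 ∷ 12 ∷ 15 ∷ 14 ∷ [] , 3 ∷ 4 ∷ 2 ∷ 3 ∷ 2 ∷ 3 ∷ 1 ∷ 2 ∷ 2 ∷ 3 ∷ 1 ∷ 2 ∷ 1 ∷ 2 ∷ 0 ∷ 1 ∷ [])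
  ∷ (1 ∷ 0 ∷ 3 ∷ 2 ∷ 5 ∷ 4 ∷ 7 ∷ 6 ∷ 9 ∷ 8 ∷ 11 ∷ 10 ∷ 14 ∷ 15 ∷ 12 ∷ 13 ∷ [] , 5 ∷ 6 ∷ 4 ∷ 5 ∷ 4 ∷ 5 ∷ 3 ∷ 4 ∷ 4 ∷ 5 ∷ 3 ∷ 4 ∷ 1 ∷ 0 ∷ 2 ∷ 1 ∷ [])
  ∷ (1 ∷ 0 ∷ 3 ∷ 2 ∷ 5 ∷ 4 ∷ 7 ∷ 6 ∷ 9 ∷ 8 ∷ 14 ∷ 15 ∷ 13 ∷ 12 ∷ 10 ∷ 11 ∷ [] , 5 ∷ 6 ∷ 4 ∷ 5 ∷ 4 ∷ 5 ∷ 3 ∷ 4 ∷ 4 ∷ 5 ∷ 1 ∷ 0 ∷ 3 ∷ 4 ∷ 2 ∷ 1 ∷ [])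
  ∷ (1 ∷ 0 ∷ 3 ∷ 2 ∷ 5 ∷ 4 ∷ 7 ∷ 6 ∷ 10 ∷ 11 ∷ 8 ∷ 9 ∷ 13 ∷ 12 ∷ 15 ∷ 14 ∷ [] , 7 ∷ 8 ∷ 6 ∷ 7 ∷ 2 ∷ 3 ∷ 1 ∷ 2 ∷ 4 ∷ 3 ∷ 5 ∷ 4 ∷ 1 ∷ 2 ∷ 0 ∷ 1 ∷ [])
  ∷ (1 ∷ 0 ∷ 3 ∷ 2 ∷ 5 ∷ 4 ∷ 7 ∷ 6 ∷ 10 ∷ 11 ∷ 8 ∷ 9 ∷ 14 ∷ 15 ∷ 12 ∷ 13 ∷ [] , 5 ∷ 6 ∷ 4 ∷ 5 ∷ 4 ∷ 5 ∷ 3 ∷ 4 ∷ 2 ∷ 1 ∷ 3 ∷ 2 ∷ 1 ∷ 0 ∷ 2 ∷ 1 ∷ [])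
  ∷ (1 ∷ 0 ∷ 3 ∷ 2 ∷ 5 ∷ 4 ∷ 7 ∷ 6 ∷ 10 ∷ 13 ∷ 8 ∷ 15 ∷ 14 ∷ 9 ∷ 12 ∷ 11 ∷ [] , 7 ∷ 8 ∷ 6 ∷ 7 ∷ 6 ∷ 7 ∷ 5 ∷ 6 ∷ 4 ∷ 1 ∷ 5 ∷ 0 ∷ 3 ∷ 2 ∷ 4 ∷ 1 ∷ [])
  ∷ (1 ∷ 0 ∷ 3 ∷ 2 ∷ 5 ∷ 4 ∷ 7 ∷ 6 ∷ 12 ∷ 11 ∷ 14 ∷ 9 ∷ 8 ∷ 15 ∷ 10 ∷ 13 ∷ [] , 7 ∷ 8 ∷ 6 ∷ 7 ∷ 6 ∷ 7 ∷ 5 ∷ 6 ∷ 4 ∷ 1 ∷ 3 ∷ 2 ∷ 5 ∷ 0 ∷ 4 ∷ 1 ∷ [])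
  ∷ (1 ∷ 0 ∷ 3 ∷ 2 ∷ 5 ∷ 4 ∷ 7 ∷ 6 ∷ 12 ∷ 13 ∷ 11 ∷ 10 ∷ 8 ∷ 9 ∷ 15 ∷ 14 ∷ [] , 7 ∷ 8 ∷ 2 ∷ 3 ∷ 6 ∷ 7 ∷ 1 ∷ 2 ∷ 4 ∷ 3 ∷ 1 ∷ 2 ∷ 5 ∷ 4 ∷ 0 ∷ 1 ∷ [])
  ∷ (1 ∷ 0 ∷ 3 ∷ 2 ∷ 5 ∷ 4 ∷ 7 ∷ 6 ∷ 12 ∷ 13 ∷ 14 ∷ 15 ∷ 8 ∷ 9 ∷ 10 ∷ 11 ∷ [] , 5 ∷ 6 ∷ 4 ∷ 5 ∷ 4 ∷ 5 ∷ 3 ∷ 4 ∷ 2 ∷ 1 ∷ 1 ∷ 0 ∷ 3 ∷ 2 ∷ 2 ∷ 1 ∷ [])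
  ∷ (1 ∷ 0 ∷ 3 ∷ 2 ∷ 5 ∷ 4 ∷ 14 ∷ 15 ∷ 9 ∷ 8 ∷ 11 ∷ 10 ∷ 13 ∷ 12 ∷ 6 ∷ 7 ∷ [] , 5 ∷ 6 ∷ 4 ∷ 5 ∷ 4 ∷ 5 ∷ 1 ∷ 0 ∷ 4 ∷ 5 ∷ 3 ∷ 4 ∷ 3 ∷ 4 ∷ 2 ∷ 1 ∷ [])
  ∷ (1 ∷ 0 ∷ 3 ∷ 2 ∷ 5 ∷ 4 ∷ 14 ∷ 15 ∷ 10 ∷ 11 ∷ 8 ∷ 9 ∷ 13 ∷ 12 ∷ 6 ∷ 7 ∷ [] , 9 ∷ 10 ∷ 8 ∷ 9 ∷ 4 ∷ 5 ∷ 1 ∷ 0 ∷ 6 ∷ 5 ∷ 7 ∷ 6 ∷ 3 ∷ 4 ∷ 2 ∷ 1 ∷ [])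
  ∷ (1 ∷ 0 ∷ 3 ∷ 2 ∷ 5 ∷ 4 ∷ 14 ∷ 15 ∷ 12 ∷ 13 ∷ 11 ∷ 10 ∷ 8 ∷ 9 ∷ 6 ∷ 7 ∷ [] , 9 ∷ 10 ∷ 4 ∷ 5 ∷ 8 ∷ 9 ∷ 1 ∷ 0 ∷ 6 ∷ 5 ∷ 3 ∷ 4 ∷ 7 ∷ 6 ∷ 2 ∷ 1 ∷ [])
  ∷ (1 ∷ 0 ∷ 3 ∷ 2 ∷ 6 ∷ 7 ∷ 4 ∷ 5 ∷ 9 ∷ 8 ∷ 11 ∷ 10 ∷ 13 ∷ 12 ∷ 15 ∷ 14 ∷ [] , 7 ∷ 8 ∷ 6 ∷ 7 ∷ 4 ∷ 3 ∷ 5 ∷ 4 ∷ 2 ∷ 3 ∷ 1 ∷ 2 ∷ 1 ∷ 2 ∷ 0 ∷ 1 ∷ [])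
  ∷ (1 ∷ 0 ∷ 3 ∷ 2 ∷ 6 ∷ 7 ∷ 4 ∷ 5 ∷ 9 ∷ 8 ∷ 11 ∷ 10 ∷ 14 ∷ 15 ∷ 12 ∷ 13 ∷ [] , 5 ∷ 6 ∷ 4 ∷ 5 ∷ 2 ∷ 1 ∷ 3 ∷ 2 ∷ 4 ∷ 5 ∷ 3 ∷ 4 ∷ 1 ∷ 0 ∷ 2 ∷ 1 ∷ [])
  ∷ (1 ∷ 0 ∷ 3 ∷ 2 ∷ 6 ∷ 7 ∷ 4 ∷ 5 ∷ 9 ∷ 8 ∷ 14 ∷ 15 ∷ 13 ∷ 12 ∷ 10 ∷ 11 ∷ [] , 9 ∷ 10 ∷ 8 ∷ 9 ∷ 6 ∷ 5 ∷ 7 ∷ 6 ∷ 4 ∷ 5 ∷ 1 ∷ 0 ∷ 3 ∷ 4 ∷ 2 ∷ 1 ∷ [])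
  ∷ (1 ∷ 0 ∷ 3 ∷ 2 ∷ 6 ∷ 7 ∷ 4 ∷ 5 ∷ 10 ∷ 11 ∷ 8 ∷ 9 ∷ 13 ∷ 12 ∷ 15 ∷ 14 ∷ [] , 7 ∷ 8 ∷ 6 ∷ 7 ∷ 4 ∷ 3 ∷ 5 ∷ 4 ∷ 4 ∷ 3 ∷ 5 ∷ 4 ∷ 1 ∷ 2 ∷ 0 ∷ 1 ∷ [])
  ∷ (1 ∷ 0 ∷ 3 ∷ 2 ∷ 6 ∷ 7 ∷ 4 ∷ 5 ∷ 10 ∷ 11 ∷ 8 ∷ 9 ∷ 14 ∷ 15 ∷ 12 ∷ 13 ∷ [] , 5 ∷ 6 ∷ 4 ∷ 5 ∷ 2 ∷ 1 ∷ 3 ∷ 2 ∷ 2 ∷ 1 ∷ 3 ∷ 2 ∷ 1 ∷ 0 ∷ 2 ∷ 1 ∷ [])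
  ∷ (1 ∷ 0 ∷ 3 ∷ 2 ∷ 6 ∷ 7 ∷ 4 ∷ 5 ∷ 10 ∷ 13 ∷ 8 ∷ 15 ∷ 14 ∷ 9 ∷ 12 ∷ 11 ∷ [] , 7 ∷ 8 ∷ 6 ∷ 7 ∷ 4 ∷ 3 ∷ 5 ∷ 4 ∷ 4 ∷ 1 ∷ 5 ∷ 0 ∷ 3 ∷ 2 ∷ 4 ∷ 1 ∷ [])
  ∷ (1 ∷ 0 ∷ 3 ∷ 2 ∷ 6 ∷ 7 ∷ 4 ∷ 5 ∷ 12 ∷ 11 ∷ 14 ∷ 9 ∷ 8 ∷ 15 ∷ 10 ∷ 13 ∷ [] , 9 ∷ 10 ∷ 8 ∷ 9 ∷ 6 ∷ 1 ∷ 7 ∷ 2 ∷ 4 ∷ 1 ∷ 3 ∷ 2 ∷ 5 ∷ 0 ∷ 4 ∷ 1 ∷ [])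
  ∷ (1 ∷ 0 ∷ 3 ∷ 2 ∷ 6 ∷ 7 ∷ 4 ∷ 5 ∷ 12 ∷ 13 ∷ 11 ∷ 10 ∷ 8 ∷ 9 ∷ 15 ∷ 14 ∷ [] , 9 ∷ 10 ∷ 8 ∷ 9 ∷ 6 ∷ 5 ∷ 7 ∷ 6 ∷ 4 ∷ 3 ∷ 1 ∷ 2 ∷ 5 ∷ 4 ∷ 0 ∷ 1 ∷ [])
  ∷ (1 ∷ 0 ∷ 3 ∷ 2 ∷ 6 ∷ 7 ∷ 4 ∷ 5 ∷ 12 ∷ 13 ∷ 14 ∷ 15 ∷ 8 ∷ 9 ∷ 10 ∷ 11 ∷ [] , 7 ∷ 8 ∷ 6 ∷ 7 ∷ 4 ∷ 3 ∷ 5 ∷ 4 ∷ 2 ∷ 1 ∷ 1 ∷ 0 ∷ 3 ∷ 2 ∷ 2 ∷ 1 ∷ [])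
  ∷ (1 ∷ 0 ∷ 3 ∷ 2 ∷ 6 ∷ 13 ∷ 4 ∷ 15 ∷ 9 ∷ 8 ∷ 11 ∷ 10 ∷ 14 ∷ 5 ∷ 12 ∷ 7 ∷ [] , 7 ∷ 8 ∷ 6 ∷ 7 ∷ 4 ∷ 1 ∷ 5 ∷ 0 ∷ 6 ∷ 7 ∷ 5 ∷ 6 ∷ 3 ∷ 2 ∷ 4 ∷ 1 ∷ [])
  ∷ (1 ∷ 0 ∷ 3 ∷ 2 ∷ 6 ∷ 13 ∷ 4 ∷ 15 ∷ 10 ∷ 11 ∷ 8 ∷ 9 ∷ 14 ∷ 5 ∷ 12 ∷ 7 ∷ [] , 7 ∷ 8 ∷ 6 ∷ 7 ∷ 4 ∷ 1 ∷ 5 ∷ 0 ∷ 4 ∷ 3 ∷ 5 ∷ 4 ∷ 3 ∷ 2 ∷ 4 ∷ 1 ∷ [])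
  ∷ (1 ∷ 0 ∷ 3 ∷ 2 ∷ 6 ∷ 13 ∷ 4 ∷ 15 ∷ 12 ∷ 11 ∷ 14 ∷ 9 ∷ 8 ∷ 5 ∷ 10 ∷ 7 ∷ [] , 11 ∷ 12 ∷ 10 ∷ 11 ∷ 8 ∷ 1 ∷ 9 ∷ 0 ∷ 6 ∷ 3 ∷ 5 ∷ 4 ∷ 7 ∷ 2 ∷ 6 ∷ 1 ∷ [])
  ∷ (1 ∷ 0 ∷ 3 ∷ 2 ∷ 12 ∷ 7 ∷ 14 ∷ 5 ∷ 9 ∷ 8 ∷ 11 ∷ 10 ∷ 4 ∷ 15 ∷ 6 ∷ 13 ∷ [] , 7 ∷ 8 ∷ 6 ∷ 7 ∷ 4 ∷ 1 ∷ 3 ∷ 2 ∷ 6 ∷ 7 ∷ 5 ∷ 6 ∷ 5 ∷ 0 ∷ 4 ∷ 1 ∷ [])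
  ∷ (1 ∷ 0 ∷ 3 ∷ 2 ∷ 12 ∷ 7 ∷ 14 ∷ 5 ∷ 10 ∷ 11 ∷ 8 ∷ 9 ∷ 4 ∷ 15 ∷ 6 ∷ 13 ∷ [] , 9 ∷ 10 ∷ 8 ∷ 9 ∷ 4 ∷ 1 ∷ 3 ∷ 2 ∷ 6 ∷ 1 ∷ 7 ∷ 2 ∷ 5 ∷ 0 ∷ 4 ∷ 1 ∷ [])
  ∷ (1 ∷ 0 ∷ 3 ∷ 2 ∷ 12 ∷ 7 ∷ 14 ∷ 5 ∷ 10 ∷ 13 ∷ 8 ∷ 15 ∷ 4 ∷ 9 ∷ 6 ∷ 11 ∷ [] , 11 ∷ 12 ∷ 10 ∷ 11 ∷ 6 ∷ 3 ∷ 5 ∷ 4 ∷ 8 ∷ 1 ∷ 9 ∷ 0 ∷ 7 ∷ 2 ∷ 6 ∷ 1 ∷ [])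
  ∷ (1 ∷ 0 ∷ 3 ∷ 2 ∷ 12 ∷ 13 ∷ 7 ∷ 6 ∷ 9 ∷ 8 ∷ 11 ∷ 10 ∷ 4 ∷ 5 ∷ 15 ∷ 14 ∷ [] , 7 ∷ 8 ∷ 2 ∷ 3 ∷ 4 ∷ 3 ∷ 1 ∷ 2 ∷ 6 ∷ 7 ∷ 1 ∷ 2 ∷ 5 ∷ 4 ∷ 0 ∷ 1 ∷ [])
  ∷ (1 ∷ 0 ∷ 3 ∷ 2 ∷ 12 ∷ 13 ∷ 7 ∷ 6 ∷ 9 ∷ 8 ∷ 14 ∷ 15 ∷ 4 ∷ 5 ∷ 10 ∷ 11 ∷ [] , 9 ∷ 10 ∷ 4 ∷ 5 ∷ 6 ∷ 5 ∷ 3 ∷ 4 ∷ 8 ∷ 9 ∷ 1 ∷ 0 ∷ 7 ∷ 6 ∷ 2 ∷ 1 ∷ [])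
  ∷ (1 ∷ 0 ∷ 3 ∷ 2 ∷ 12 ∷ 13 ∷ 7 ∷ 6 ∷ 10 ∷ 11 ∷ 8 ∷ 9 ∷ 4 ∷ 5 ∷ 15 ∷ 14 ∷ [] , 9 ∷ 10 ∷ 8 ∷ 9 ∷ 4 ∷ 3 ∷ 1 ∷ 2 ∷ 6 ∷ 5 ∷ 7 ∷ 6 ∷ 5 ∷ 4 ∷ 0 ∷ 1 ∷ [])
  ∷ (1 ∷ 0 ∷ 3 ∷ 2 ∷ 12 ∷ 13 ∷ 14 ∷ 15 ∷ 9 ∷ 8 ∷ 11 ∷ 10 ∷ 4 ∷ 5 ∷ 6 ∷ 7 ∷ [] , 5 ∷ 6 ∷ 4 ∷ 5 ∷ 2 ∷ 1 ∷ 1 ∷ 0 ∷ 4 ∷ 5 ∷ 3 ∷ 4 ∷ 3 ∷ 2 ∷ 2 ∷ 1 ∷ [])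
  ∷ (1 ∷ 0 ∷ 3 ∷ 2 ∷ 12 ∷ 13 ∷ 14 ∷ 15 ∷ 10 ∷ 11 ∷ 8 ∷ 9 ∷ 4 ∷ 5 ∷ 6 ∷ 7 ∷ [] , 7 ∷ 8 ∷ 6 ∷ 7 ∷ 2 ∷ 1 ∷ 1 ∷ 0 ∷ 4 ∷ 3 ∷ 5 ∷ 4 ∷ 3 ∷ 2 ∷ 2 ∷ 1 ∷ [])
  ∷ (1 ∷ 0 ∷ 6 ∷ 7 ∷ 5 ∷ 4 ∷ 2 ∷ 3 ∷ 9 ∷ 8 ∷ 11 ∷ 10 ∷ 13 ∷ 12 ∷ 15 ∷ 14 ∷ [] , 7 ∷ 8 ∷ 4 ∷ 3 ∷ 6 ∷ 7 ∷ 5 ∷ 4 ∷ 2 ∷ 3 ∷ 1 ∷ 2 ∷ 1 ∷ 2 ∷ 0 ∷ 1 ∷ [])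
  ∷ (1 ∷ 0 ∷ 6 ∷ 7 ∷ 5 ∷ 4 ∷ 2 ∷ 3 ∷ 9 ∷ 8 ∷ 11 ∷ 10 ∷ 14 ∷ 15 ∷ 12 ∷ 13 ∷ [] , 9 ∷ 10 ∷ 6 ∷ 5 ∷ 8 ∷ 9 ∷ 7 ∷ 6 ∷ 4 ∷ 5 ∷ 3 ∷ 4 ∷ 1 ∷ 0 ∷ 2 ∷ 1 ∷ [])
  ∷ (1 ∷ 0 ∷ 6 ∷ 7 ∷ 5 ∷ 4 ∷ 2 ∷ 3 ∷ 9 ∷ 8 ∷ 14 ∷ 15 ∷ 13 ∷ 12 ∷ 10 ∷ 11 ∷ [] , 5 ∷ 6 ∷ 2 ∷ 1 ∷ 4 ∷ 5 ∷ 3 ∷ 2 ∷ 4 ∷ 5 ∷ 1 ∷ 0 ∷ 3 ∷ 4 ∷ 2 ∷ 1 ∷ [])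
  ∷ (1 ∷ 0 ∷ 6 ∷ 7 ∷ 5 ∷ 4 ∷ 2 ∷ 3 ∷ 10 ∷ 11 ∷ 8 ∷ 9 ∷ 13 ∷ 12 ∷ 15 ∷ 14 ∷ [] , 9 ∷ 10 ∷ 6 ∷ 5 ∷ 8 ∷ 9 ∷ 7 ∷ 6 ∷ 4 ∷ 3 ∷ 5 ∷ 4 ∷ 1 ∷ 2 ∷ 0 ∷ 1 ∷ [])
  ∷ (1 ∷ 0 ∷ 6 ∷ 7 ∷ 5 ∷ 4 ∷ 2 ∷ 3 ∷ 10 ∷ 11 ∷ 8 ∷ 9 ∷ 14 ∷ 15 ∷ 12 ∷ 13 ∷ [] , 7 ∷ 8 ∷ 4 ∷ 3 ∷ 6 ∷ 7 ∷ 5 ∷ 4 ∷ 2 ∷ 1 ∷ 3 ∷ 2 ∷ 1 ∷ 0 ∷ 2 ∷ 1 ∷ [])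
  ∷ (1 ∷ 0 ∷ 6 ∷ 7 ∷ 5 ∷ 4 ∷ 2 ∷ 3 ∷ 10 ∷ 13 ∷ 8 ∷ 15 ∷ 14 ∷ 9 ∷ 12 ∷ 11 ∷ [] , 9 ∷ 10 ∷ 6 ∷ 1 ∷ 8 ∷ 9 ∷ 7 ∷ 2 ∷ 4 ∷ 1 ∷ 5 ∷ 0 ∷ 3 ∷ 2 ∷ 4 ∷ 1 ∷ [])
  ∷ (1 ∷ 0 ∷ 6 ∷ 7 ∷ 5 ∷ 4 ∷ 2 ∷ 3 ∷ 12 ∷ 11 ∷ 14 ∷ 9 ∷ 8 ∷ 15 ∷ 10 ∷ 13 ∷ [] , 7 ∷ 8 ∷ 4 ∷ 3 ∷ 6 ∷ 7 ∷ 5 ∷ 4 ∷ 4 ∷ 1 ∷ 3 ∷ 2 ∷ 5 ∷ 0 ∷ 4 ∷ 1 ∷ [])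
  ∷ (1 ∷ 0 ∷ 6 ∷ 7 ∷ 5 ∷ 4 ∷ 2 ∷ 3 ∷ 12 ∷ 13 ∷ 11 ∷ 10 ∷ 8 ∷ 9 ∷ 15 ∷ 14 ∷ [] , 7 ∷ 8 ∷ 4 ∷ 3 ∷ 6 ∷ 7 ∷ 5 ∷ 4 ∷ 4 ∷ 3 ∷ 1 ∷ 2 ∷ 5 ∷ 4 ∷ 0 ∷ 1 ∷ [])
  ∷ (1 ∷ 0 ∷ 6 ∷ 7 ∷ 5 ∷ 4 ∷ 2 ∷ 3 ∷ 12 ∷ 13 ∷ 14 ∷ 15 ∷ 8 ∷ 9 ∷ 10 ∷ 11 ∷ [] , 5 ∷ 6 ∷ 2 ∷ 1 ∷ 4 ∷ 5 ∷ 3 ∷ 2 ∷ 2 ∷ 1 ∷ 1 ∷ 0 ∷ 3 ∷ 2 ∷ 2 ∷ 1 ∷ [])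
  ∷ (1 ∷ 0 ∷ 6 ∷ 7 ∷ 12 ∷ 13 ∷ 2 ∷ 3 ∷ 9 ∷ 8 ∷ 11 ∷ 10 ∷ 4 ∷ 5 ∷ 15 ∷ 14 ∷ [] , 9 ∷ 10 ∷ 4 ∷ 3 ∷ 6 ∷ 5 ∷ 5 ∷ 4 ∷ 8 ∷ 9 ∷ 1 ∷ 2 ∷ 7 ∷ 6 ∷ 0 ∷ 1 ∷ [])
  ∷ (1 ∷ 0 ∷ 6 ∷ 7 ∷ 12 ∷ 13 ∷ 2 ∷ 3 ∷ 9 ∷ 8 ∷ 14 ∷ 15 ∷ 4 ∷ 5 ∷ 10 ∷ 11 ∷ [] , 7 ∷ 8 ∷ 2 ∷ 1 ∷ 4 ∷ 3 ∷ 3 ∷ 2 ∷ 6 ∷ 7 ∷ 1 ∷ 0 ∷ 5 ∷ 4 ∷ 2 ∷ 1 ∷ [])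
  ∷ (1 ∷ 0 ∷ 6 ∷ 11 ∷ 5 ∷ 4 ∷ 2 ∷ 15 ∷ 9 ∷ 8 ∷ 14 ∷ 3 ∷ 13 ∷ 12 ∷ 10 ∷ 7 ∷ [] , 7 ∷ 8 ∷ 4 ∷ 1 ∷ 6 ∷ 7 ∷ 5 ∷ 0 ∷ 6 ∷ 7 ∷ 3 ∷ 2 ∷ 5 ∷ 6 ∷ 4 ∷ 1 ∷ [])
  ∷ (1 ∷ 0 ∷ 6 ∷ 11 ∷ 5 ∷ 4 ∷ 2 ∷ 15 ∷ 10 ∷ 13 ∷ 8 ∷ 3 ∷ 14 ∷ 9 ∷ 12 ∷ 7 ∷ [] , 11 ∷ 12 ∷ 8 ∷ 1 ∷ 10 ∷ 11 ∷ 9 ∷ 0 ∷ 6 ∷ 3 ∷ 7 ∷ 2 ∷ 5 ∷ 4 ∷ 6 ∷ 1 ∷ [])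
  ∷ (1 ∷ 0 ∷ 6 ∷ 11 ∷ 5 ∷ 4 ∷ 2 ∷ 15 ∷ 12 ∷ 13 ∷ 14 ∷ 3 ∷ 8 ∷ 9 ∷ 10 ∷ 7 ∷ [] , 7 ∷ 8 ∷ 4 ∷ 1 ∷ 6 ∷ 7 ∷ 5 ∷ 0 ∷ 4 ∷ 3 ∷ 3 ∷ 2 ∷ 5 ∷ 4 ∷ 4 ∷ 1 ∷ [])
  ∷ (1 ∷ 0 ∷ 6 ∷ 11 ∷ 12 ∷ 7 ∷ 2 ∷ 5 ∷ 9 ∷ 8 ∷ 14 ∷ 3 ∷ 4 ∷ 15 ∷ 10 ∷ 13 ∷ [] , 11 ∷ 12 ∷ 6 ∷ 3 ∷ 8 ∷ 1 ∷ 7 ∷ 2 ∷ 10 ∷ 11 ∷ 5 ∷ 4 ∷ 9 ∷ 0 ∷ 6 ∷ 1 ∷ [])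
  ∷ (1 ∷ 0 ∷ 6 ∷ 11 ∷ 12 ∷ 13 ∷ 2 ∷ 15 ∷ 9 ∷ 8 ∷ 14 ∷ 3 ∷ 4 ∷ 5 ∷ 10 ∷ 7 ∷ [] , 9 ∷ 10 ∷ 4 ∷ 1 ∷ 6 ∷ 1 ∷ 5 ∷ 0 ∷ 8 ∷ 9 ∷ 3 ∷ 2 ∷ 7 ∷ 2 ∷ 4 ∷ 1 ∷ [])
  ∷ (1 ∷ 0 ∷ 10 ∷ 7 ∷ 5 ∷ 4 ∷ 14 ∷ 3 ∷ 9 ∷ 8 ∷ 2 ∷ 15 ∷ 13 ∷ 12 ∷ 6 ∷ 11 ∷ [] , 7 ∷ 8 ∷ 4 ∷ 1 ∷ 6 ∷ 7 ∷ 3 ∷ 2 ∷ 6 ∷ 7 ∷ 5 ∷ 0 ∷ 5 ∷ 6 ∷ 4 ∷ 1 ∷ [])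
  ∷ (1 ∷ 0 ∷ 10 ∷ 7 ∷ 5 ∷ 4 ∷ 14 ∷ 3 ∷ 12 ∷ 11 ∷ 2 ∷ 9 ∷ 8 ∷ 15 ∷ 6 ∷ 13 ∷ [] , 11 ∷ 12 ∷ 6 ∷ 3 ∷ 10 ∷ 11 ∷ 5 ∷ 4 ∷ 8 ∷ 1 ∷ 7 ∷ 2 ∷ 9 ∷ 0 ∷ 6 ∷ 1 ∷ [])
  ∷ (1 ∷ 0 ∷ 10 ∷ 7 ∷ 5 ∷ 4 ∷ 14 ∷ 3 ∷ 12 ∷ 13 ∷ 2 ∷ 15 ∷ 8 ∷ 9 ∷ 6 ∷ 11 ∷ [] , 9 ∷ 10 ∷ 4 ∷ 1 ∷ 8 ∷ 9 ∷ 3 ∷ 2 ∷ 6 ∷ 1 ∷ 5 ∷ 0 ∷ 7 ∷ 2 ∷ 4 ∷ 1 ∷ [])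
  ∷ (1 ∷ 0 ∷ 10 ∷ 7 ∷ 6 ∷ 13 ∷ 4 ∷ 3 ∷ 9 ∷ 8 ∷ 2 ∷ 15 ∷ 14 ∷ 5 ∷ 12 ∷ 11 ∷ [] , 11 ∷ 12 ∷ 8 ∷ 1 ∷ 6 ∷ 3 ∷ 7 ∷ 2 ∷ 10 ∷ 11 ∷ 9 ∷ 0 ∷ 5 ∷ 4 ∷ 6 ∷ 1 ∷ [])
  ∷ (1 ∷ 0 ∷ 10 ∷ 7 ∷ 12 ∷ 13 ∷ 14 ∷ 3 ∷ 9 ∷ 8 ∷ 2 ∷ 15 ∷ 4 ∷ 5 ∷ 6 ∷ 11 ∷ [] , 7 ∷ 8 ∷ 4 ∷ 1 ∷ 4 ∷ 3 ∷ 3 ∷ 2 ∷ 6 ∷ 7 ∷ 5 ∷ 0 ∷ 5 ∷ 4 ∷ 4 ∷ 1 ∷ [])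
  ∷ (1 ∷ 0 ∷ 10 ∷ 11 ∷ 5 ∷ 4 ∷ 7 ∷ 6 ∷ 9 ∷ 8 ∷ 2 ∷ 3 ∷ 13 ∷ 12 ∷ 15 ∷ 14 ∷ [] , 7 ∷ 8 ∷ 4 ∷ 3 ∷ 2 ∷ 3 ∷ 1 ∷ 2 ∷ 6 ∷ 7 ∷ 5 ∷ 4 ∷ 1 ∷ 2 ∷ 0 ∷ 1 ∷ [])
  ∷ (1 ∷ 0 ∷ 10 ∷ 11 ∷ 5 ∷ 4 ∷ 7 ∷ 6 ∷ 9 ∷ 8 ∷ 2 ∷ 3 ∷ 14 ∷ 15 ∷ 12 ∷ 13 ∷ [] , 9 ∷ 10 ∷ 6 ∷ 5 ∷ 4 ∷ 5 ∷ 3 ∷ 4 ∷ 8 ∷ 9 ∷ 7 ∷ 6 ∷ 1 ∷ 0 ∷ 2 ∷ 1 ∷ [])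
  ∷ (1 ∷ 0 ∷ 10 ∷ 11 ∷ 5 ∷ 4 ∷ 7 ∷ 6 ∷ 12 ∷ 13 ∷ 2 ∷ 3 ∷ 8 ∷ 9 ∷ 15 ∷ 14 ∷ [] , 9 ∷ 10 ∷ 4 ∷ 3 ∷ 8 ∷ 9 ∷ 1 ∷ 2 ∷ 6 ∷ 5 ∷ 5 ∷ 4 ∷ 7 ∷ 6 ∷ 0 ∷ 1 ∷ [])
  ∷ (1 ∷ 0 ∷ 10 ∷ 11 ∷ 5 ∷ 4 ∷ 14 ∷ 15 ∷ 9 ∷ 8 ∷ 2 ∷ 3 ∷ 13 ∷ 12 ∷ 6 ∷ 7 ∷ [] , 5 ∷ 6 ∷ 2 ∷ 1 ∷ 4 ∷ 5 ∷ 1 ∷ 0 ∷ 4 ∷ 5 ∷ 3 ∷ 2 ∷ 3 ∷ 4 ∷ 2 ∷ 1 ∷ [])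
  ∷ (1 ∷ 0 ∷ 10 ∷ 11 ∷ 5 ∷ 4 ∷ 14 ∷ 15 ∷ 12 ∷ 13 ∷ 2 ∷ 3 ∷ 8 ∷ 9 ∷ 6 ∷ 7 ∷ [] , 7 ∷ 8 ∷ 2 ∷ 1 ∷ 6 ∷ 7 ∷ 1 ∷ 0 ∷ 4 ∷ 3 ∷ 3 ∷ 2 ∷ 5 ∷ 4 ∷ 2 ∷ 1 ∷ [])
  ∷ (1 ∷ 0 ∷ 10 ∷ 11 ∷ 6 ∷ 7 ∷ 4 ∷ 5 ∷ 9 ∷ 8 ∷ 2 ∷ 3 ∷ 13 ∷ 12 ∷ 15 ∷ 14 ∷ [] , 9 ∷ 10 ∷ 6 ∷ 5 ∷ 4 ∷ 3 ∷ 5 ∷ 4 ∷ 8 ∷ 9 ∷ 7 ∷ 6 ∷ 1 ∷ 2 ∷ 0 ∷ 1 ∷ [])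
  ∷ (1 ∷ 0 ∷ 10 ∷ 11 ∷ 6 ∷ 7 ∷ 4 ∷ 5 ∷ 9 ∷ 8 ∷ 2 ∷ 3 ∷ 14 ∷ 15 ∷ 12 ∷ 13 ∷ [] , 7 ∷ 8 ∷ 4 ∷ 3 ∷ 2 ∷ 1 ∷ 3 ∷ 2 ∷ 6 ∷ 7 ∷ 5 ∷ 4 ∷ 1 ∷ 0 ∷ 2 ∷ 1 ∷ [])
  ∷ (1 ∷ 0 ∷ 10 ∷ 11 ∷ 6 ∷ 13 ∷ 4 ∷ 15 ∷ 9 ∷ 8 ∷ 2 ∷ 3 ∷ 14 ∷ 5 ∷ 12 ∷ 7 ∷ [] , 9 ∷ 10 ∷ 6 ∷ 1 ∷ 4 ∷ 1 ∷ 5 ∷ 0 ∷ 8 ∷ 9 ∷ 7 ∷ 2 ∷ 3 ∷ 2 ∷ 4 ∷ 1 ∷ [])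
  ∷ (1 ∷ 0 ∷ 10 ∷ 11 ∷ 12 ∷ 7 ∷ 14 ∷ 5 ∷ 9 ∷ 8 ∷ 2 ∷ 3 ∷ 4 ∷ 15 ∷ 6 ∷ 13 ∷ [] , 7 ∷ 8 ∷ 4 ∷ 3 ∷ 4 ∷ 1 ∷ 3 ∷ 2 ∷ 6 ∷ 7 ∷ 5 ∷ 4 ∷ 5 ∷ 0 ∷ 4 ∷ 1 ∷ [])
  ∷ (1 ∷ 0 ∷ 10 ∷ 11 ∷ 12 ∷ 13 ∷ 7 ∷ 6 ∷ 9 ∷ 8 ∷ 2 ∷ 3 ∷ 4 ∷ 5 ∷ 15 ∷ 14 ∷ [] , 7 ∷ 8 ∷ 4 ∷ 3 ∷ 4 ∷ 3 ∷ 1 ∷ 2 ∷ 6 ∷ 7 ∷ 5 ∷ 4 ∷ 5 ∷ 4 ∷ 0 ∷ 1 ∷ [])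
  ∷ (1 ∷ 0 ∷ 10 ∷ 11 ∷ 12 ∷ 13 ∷ 14 ∷ 15 ∷ 9 ∷ 8 ∷ 2 ∷ 3 ∷ 4 ∷ 5 ∷ 6 ∷ 7 ∷ [] , 5 ∷ 6 ∷ 2 ∷ 1 ∷ 2 ∷ 1 ∷ 1 ∷ 0 ∷ 4 ∷ 5 ∷ 3 ∷ 2 ∷ 3 ∷ 2 ∷ 2 ∷ 1 ∷ [])
  ∷ (2 ∷ 3 ∷ 0 ∷ 1 ∷ 5 ∷ 4 ∷ 7 ∷ 6 ∷ 9 ∷ 8 ∷ 11 ∷ 10 ∷ 13 ∷ 12 ∷ 15 ∷ 14 ∷ [] , 5 ∷ 4 ∷ 6 ∷ 5 ∷ 2 ∷ 3 ∷ 1 ∷ 2 ∷ 2 ∷ 3 ∷ 1 ∷ 2 ∷ 1 ∷ 2 ∷ 0 ∷ 1 ∷ [])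
  ∷ (2 ∷ 3 ∷ 0 ∷ 1 ∷ 5 ∷ 4 ∷ 7 ∷ 6 ∷ 9 ∷ 8 ∷ 11 ∷ 10 ∷ 14 ∷ 15 ∷ 12 ∷ 13 ∷ [] , 7 ∷ 6 ∷ 8 ∷ 7 ∷ 4 ∷ 5 ∷ 3 ∷ 4 ∷ 4 ∷ 5 ∷ 3 ∷ 4 ∷ 1 ∷ 0 ∷ 2 ∷ 1 ∷ [])
  ∷ (2 ∷ 3 ∷ 0 ∷ 1 ∷ 5 ∷ 4 ∷ 7 ∷ 6 ∷ 9 ∷ 8 ∷ 14 ∷ 15 ∷ 13 ∷ 12 ∷ 10 ∷ 11 ∷ [] , 7 ∷ 6 ∷ 8 ∷ 7 ∷ 4 ∷ 5 ∷ 3 ∷ 4 ∷ 4 ∷ 5 ∷ 1 ∷ 0 ∷ 3 ∷ 4 ∷ 2 ∷ 1 ∷ [])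
  ∷ (2 ∷ 3 ∷ 0 ∷ 1 ∷ 5 ∷ 4 ∷ 7 ∷ 6 ∷ 10 ∷ 11 ∷ 8 ∷ 9 ∷ 13 ∷ 12 ∷ 15 ∷ 14 ∷ [] , 5 ∷ 4 ∷ 6 ∷ 5 ∷ 2 ∷ 3 ∷ 1 ∷ 2 ∷ 4 ∷ 3 ∷ 5 ∷ 4 ∷ 1 ∷ 2 ∷ 0 ∷ 1 ∷ [])
  ∷ (2 ∷ 3 ∷ 0 ∷ 1 ∷ 5 ∷ 4 ∷ 7 ∷ 6 ∷ 10 ∷ 11 ∷ 8 ∷ 9 ∷ 14 ∷ 15 ∷ 12 ∷ 13 ∷ [] , 7 ∷ 6 ∷ 8 ∷ 7 ∷ 4 ∷ 5 ∷ 3 ∷ 4 ∷ 2 ∷ 1 ∷ 3 ∷ 2 ∷ 1 ∷ 0 ∷ 2 ∷ 1 ∷ [])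
  ∷ (2 ∷ 3 ∷ 0 ∷ 1 ∷ 5 ∷ 4 ∷ 7 ∷ 6 ∷ 10 ∷ 13 ∷ 8 ∷ 15 ∷ 14 ∷ 9 ∷ 12 ∷ 11 ∷ [] , 9 ∷ 8 ∷ 10 ∷ 9 ∷ 6 ∷ 7 ∷ 5 ∷ 6 ∷ 4 ∷ 1 ∷ 5 ∷ 0 ∷ 3 ∷ 2 ∷ 4 ∷ 1 ∷ [])
  ∷ (2 ∷ 3 ∷ 0 ∷ 1 ∷ 5 ∷ 4 ∷ 7 ∷ 6 ∷ 12 ∷ 11 ∷ 14 ∷ 9 ∷ 8 ∷ 15 ∷ 10 ∷ 13 ∷ [] , 9 ∷ 8 ∷ 10 ∷ 9 ∷ 6 ∷ 7 ∷ 5 ∷ 6 ∷ 4 ∷ 1 ∷ 3 ∷ 2 ∷ 5 ∷ 0 ∷ 4 ∷ 1 ∷ [])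
  ∷ (2 ∷ 3 ∷ 0 ∷ 1 ∷ 5 ∷ 4 ∷ 7 ∷ 6 ∷ 12 ∷ 13 ∷ 11 ∷ 10 ∷ 8 ∷ 9 ∷ 15 ∷ 14 ∷ [] , 9 ∷ 8 ∷ 10 ∷ 9 ∷ 6 ∷ 7 ∷ 1 ∷ 2 ∷ 4 ∷ 3 ∷ 1 ∷ 2 ∷ 5 ∷ 4 ∷ 0 ∷ 1 ∷ [])
  ∷ (2 ∷ 3 ∷ 0 ∷ 1 ∷ 5 ∷ 4 ∷ 7 ∷ 6 ∷ 12 ∷ 13 ∷ 14 ∷ 15 ∷ 8 ∷ 9 ∷ 10 ∷ 11 ∷ [] , 7 ∷ 6 ∷ 8 ∷ 7 ∷ 4 ∷ 5 ∷ 3 ∷ 4 ∷ 2 ∷ 1 ∷ 1 ∷ 0 ∷ 3 ∷ 2 ∷ 2 ∷ 1 ∷ [])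
  ∷ (2 ∷ 3 ∷ 0 ∷ 1 ∷ 5 ∷ 4 ∷ 14 ∷ 15 ∷ 9 ∷ 8 ∷ 11 ∷ 10 ∷ 13 ∷ 12 ∷ 6 ∷ 7 ∷ [] , 7 ∷ 6 ∷ 8 ∷ 7 ∷ 4 ∷ 5 ∷ 1 ∷ 0 ∷ 4 ∷ 5 ∷ 3 ∷ 4 ∷ 3 ∷ 4 ∷ 2 ∷ 1 ∷ [])
  ∷ (2 ∷ 3 ∷ 0 ∷ 1 ∷ 5 ∷ 4 ∷ 14 ∷ 15 ∷ 10 ∷ 11 ∷ 8 ∷ 9 ∷ 13 ∷ 12 ∷ 6 ∷ 7 ∷ [] , 7 ∷ 6 ∷ 8 ∷ 7 ∷ 4 ∷ 5 ∷ 1 ∷ 0 ∷ 6 ∷ 5 ∷ 7 ∷ 6 ∷ 3 ∷ 4 ∷ 2 ∷ 1 ∷ [])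
  ∷ (2 ∷ 3 ∷ 0 ∷ 1 ∷ 5 ∷ 4 ∷ 14 ∷ 15 ∷ 12 ∷ 13 ∷ 11 ∷ 10 ∷ 8 ∷ 9 ∷ 6 ∷ 7 ∷ [] , 11 ∷ 10 ∷ 12 ∷ 11 ∷ 8 ∷ 9 ∷ 1 ∷ 0 ∷ 6 ∷ 5 ∷ 3 ∷ 4 ∷ 7 ∷ 6 ∷ 2 ∷ 1 ∷ [])
  ∷ (2 ∷ 3 ∷ 0 ∷ 1 ∷ 6 ∷ 7 ∷ 4 ∷ 5 ∷ 9 ∷ 8 ∷ 11 ∷ 10 ∷ 13 ∷ 12 ∷ 15 ∷ 14 ∷ [] , 5 ∷ 4 ∷ 6 ∷ 5 ∷ 4 ∷ 3 ∷ 5 ∷ 4 ∷ 2 ∷ 3 ∷ 1 ∷ 2 ∷ 1 ∷ 2 ∷ 0 ∷ 1 ∷ [])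
  ∷ (2 ∷ 3 ∷ 0 ∷ 1 ∷ 6 ∷ 7 ∷ 4 ∷ 5 ∷ 9 ∷ 8 ∷ 11 ∷ 10 ∷ 14 ∷ 15 ∷ 12 ∷ 13 ∷ [] , 7 ∷ 6 ∷ 8 ∷ 7 ∷ 2 ∷ 1 ∷ 3 ∷ 2 ∷ 4 ∷ 5 ∷ 3 ∷ 4 ∷ 1 ∷ 0 ∷ 2 ∷ 1 ∷ [])
  ∷ (2 ∷ 3 ∷ 0 ∷ 1 ∷ 6 ∷ 7 ∷ 4 ∷ 5 ∷ 9 ∷ 8 ∷ 14 ∷ 15 ∷ 13 ∷ 12 ∷ 10 ∷ 11 ∷ [] , 7 ∷ 6 ∷ 8 ∷ 7 ∷ 6 ∷ 5 ∷ 7 ∷ 6 ∷ 4 ∷ 5 ∷ 1 ∷ 0 ∷ 3 ∷ 4 ∷ 2 ∷ 1 ∷ [])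
  ∷ (2 ∷ 3 ∷ 0 ∷ 1 ∷ 6 ∷ 7 ∷ 4 ∷ 5 ∷ 10 ∷ 11 ∷ 8 ∷ 9 ∷ 13 ∷ 12 ∷ 15 ∷ 14 ∷ [] , 5 ∷ 4 ∷ 6 ∷ 5 ∷ 4 ∷ 3 ∷ 5 ∷ 4 ∷ 4 ∷ 3 ∷ 5 ∷ 4 ∷ 1 ∷ 2 ∷ 0 ∷ 1 ∷ [])
  ∷ (2 ∷ 3 ∷ 0 ∷ 1 ∷ 6 ∷ 7 ∷ 4 ∷ 5 ∷ 10 ∷ 11 ∷ 8 ∷ 9 ∷ 14 ∷ 15 ∷ 12 ∷ 13 ∷ [] , 3 ∷ 2 ∷ 4 ∷ 3 ∷ 2 ∷ 1 ∷ 3 ∷ 2 ∷ 2 ∷ 1 ∷ 3 ∷ 2 ∷ 1 ∷ 0 ∷ 2 ∷ 1 ∷ [])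
  ∷ (2 ∷ 3 ∷ 0 ∷ 1 ∷ 6 ∷ 7 ∷ 4 ∷ 5 ∷ 10 ∷ 13 ∷ 8 ∷ 15 ∷ 14 ∷ 9 ∷ 12 ∷ 11 ∷ [] , 5 ∷ 4 ∷ 6 ∷ 5 ∷ 4 ∷ 3 ∷ 5 ∷ 4 ∷ 4 ∷ 1 ∷ 5 ∷ 0 ∷ 3 ∷ 2 ∷ 4 ∷ 1 ∷ [])
  ∷ (2 ∷ 3 ∷ 0 ∷ 1 ∷ 6 ∷ 7 ∷ 4 ∷ 5 ∷ 12 ∷ 11 ∷ 14 ∷ 9 ∷ 8 ∷ 15 ∷ 10 ∷ 13 ∷ [] , 7 ∷ 2 ∷ 8 ∷ 3 ∷ 6 ∷ 1 ∷ 7 ∷ 2 ∷ 4 ∷ 1 ∷ 3 ∷ 2 ∷ 5 ∷ 0 ∷ 4 ∷ 1 ∷ [])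
  ∷ (2 ∷ 3 ∷ 0 ∷ 1 ∷ 6 ∷ 7 ∷ 4 ∷ 5 ∷ 12 ∷ 13 ∷ 11 ∷ 10 ∷ 8 ∷ 9 ∷ 15 ∷ 14 ∷ [] , 7 ∷ 6 ∷ 8 ∷ 7 ∷ 6 ∷ 5 ∷ 7 ∷ 6 ∷ 4 ∷ 3 ∷ 1 ∷ 2 ∷ 5 ∷ 4 ∷ 0 ∷ 1 ∷ [])
  ∷ (2 ∷ 3 ∷ 0 ∷ 1 ∷ 6 ∷ 7 ∷ 4 ∷ 5 ∷ 12 ∷ 13 ∷ 14 ∷ 15 ∷ 8 ∷ 9 ∷ 10 ∷ 11 ∷ [] , 5 ∷ 4 ∷ 6 ∷ 5 ∷ 4 ∷ 3 ∷ 5 ∷ 4 ∷ 2 ∷ 1 ∷ 1 ∷ 0 ∷ 3 ∷ 2 ∷ 2 ∷ 1 ∷ [])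
  ∷ (2 ∷ 3 ∷ 0 ∷ 1 ∷ 6 ∷ 13 ∷ 4 ∷ 15 ∷ 9 ∷ 8 ∷ 11 ∷ 10 ∷ 14 ∷ 5 ∷ 12 ∷ 7 ∷ [] , 9 ∷ 8 ∷ 10 ∷ 9 ∷ 4 ∷ 1 ∷ 5 ∷ 0 ∷ 6 ∷ 7 ∷ 5 ∷ 6 ∷ 3 ∷ 2 ∷ 4 ∷ 1 ∷ [])
  ∷ (2 ∷ 3 ∷ 0 ∷ 1 ∷ 6 ∷ 13 ∷ 4 ∷ 15 ∷ 10 ∷ 11 ∷ 8 ∷ 9 ∷ 14 ∷ 5 ∷ 12 ∷ 7 ∷ [] , 5 ∷ 4 ∷ 6 ∷ 5 ∷ 4 ∷ 1 ∷ 5 ∷ 0 ∷ 4 ∷ 3 ∷ 5 ∷ 4 ∷ 3 ∷ 2 ∷ 4 ∷ 1 ∷ [])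
  ∷ (2 ∷ 3 ∷ 0 ∷ 1 ∷ 6 ∷ 13 ∷ 4 ∷ 15 ∷ 12 ∷ 11 ∷ 14 ∷ 9 ∷ 8 ∷ 5 ∷ 10 ∷ 7 ∷ [] , 9 ∷ 4 ∷ 10 ∷ 5 ∷ 8 ∷ 1 ∷ 9 ∷ 0 ∷ 6 ∷ 3 ∷ 5 ∷ 4 ∷ 7 ∷ 2 ∷ 6 ∷ 1 ∷ [])
  ∷ (2 ∷ 3 ∷ 0 ∷ 1 ∷ 12 ∷ 7 ∷ 14 ∷ 5 ∷ 9 ∷ 8 ∷ 11 ∷ 10 ∷ 4 ∷ 15 ∷ 6 ∷ 13 ∷ [] , 9 ∷ 8 ∷ 10 ∷ 9 ∷ 4 ∷ 1 ∷ 3 ∷ 2 ∷ 6 ∷ 7 ∷ 5 ∷ 6 ∷ 5 ∷ 0 ∷ 4 ∷ 1 ∷ [])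
  ∷ (2 ∷ 3 ∷ 0 ∷ 1 ∷ 12 ∷ 7 ∷ 14 ∷ 5 ∷ 10 ∷ 11 ∷ 8 ∷ 9 ∷ 4 ∷ 15 ∷ 6 ∷ 13 ∷ [] , 7 ∷ 2 ∷ 8 ∷ 3 ∷ 4 ∷ 1 ∷ 3 ∷ 2 ∷ 6 ∷ 1 ∷ 7 ∷ 2 ∷ 5 ∷ 0 ∷ 4 ∷ 1 ∷ [])
  ∷ (2 ∷ 3 ∷ 0 ∷ 1 ∷ 12 ∷ 7 ∷ 14 ∷ 5 ∷ 10 ∷ 13 ∷ 8 ∷ 15 ∷ 4 ∷ 9 ∷ 6 ∷ 11 ∷ [] , 9 ∷ 4 ∷ 10 ∷ 5 ∷ 6 ∷ 3 ∷ 5 ∷ 4 ∷ 8 ∷ 1 ∷ 9 ∷ 0 ∷ 7 ∷ 2 ∷ 6 ∷ 1 ∷ [])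
  ∷ (2 ∷ 3 ∷ 0 ∷ 1 ∷ 12 ∷ 13 ∷ 7 ∷ 6 ∷ 9 ∷ 8 ∷ 11 ∷ 10 ∷ 4 ∷ 5 ∷ 15 ∷ 14 ∷ [] , 9 ∷ 8 ∷ 10 ∷ 9 ∷ 4 ∷ 3 ∷ 1 ∷ 2 ∷ 6 ∷ 7 ∷ 1 ∷ 2 ∷ 5 ∷ 4 ∷ 0 ∷ 1 ∷ [])
  ∷ (2 ∷ 3 ∷ 0 ∷ 1 ∷ 12 ∷ 13 ∷ 7 ∷ 6 ∷ 9 ∷ 8 ∷ 14 ∷ 15 ∷ 4 ∷ 5 ∷ 10 ∷ 11 ∷ [] , 11 ∷ 10 ∷ 12 ∷ 11 ∷ 6 ∷ 5 ∷ 3 ∷ 4 ∷ 8 ∷ 9 ∷ 1 ∷ 0 ∷ 7 ∷ 6 ∷ 2 ∷ 1 ∷ [])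
  ∷ (2 ∷ 3 ∷ 0 ∷ 1 ∷ 12 ∷ 13 ∷ 7 ∷ 6 ∷ 10 ∷ 11 ∷ 8 ∷ 9 ∷ 4 ∷ 5 ∷ 15 ∷ 14 ∷ [] , 7 ∷ 6 ∷ 8 ∷ 7 ∷ 4 ∷ 3 ∷ 1 ∷ 2 ∷ 6 ∷ 5 ∷ 7 ∷ 6 ∷ 5 ∷ 4 ∷ 0 ∷ 1 ∷ [])
  ∷ (2 ∷ 3 ∷ 0 ∷ 1 ∷ 12 ∷ 13 ∷ 14 ∷ 15 ∷ 9 ∷ 8 ∷ 11 ∷ 10 ∷ 4 ∷ 5 ∷ 6 ∷ 7 ∷ [] , 7 ∷ 6 ∷ 8 ∷ 7 ∷ 2 ∷ 1 ∷ 1 ∷ 0 ∷ 4 ∷ 5 ∷ 3 ∷ 4 ∷ 3 ∷ 2 ∷ 2 ∷ 1 ∷ [])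
  ∷ (2 ∷ 3 ∷ 0 ∷ 1 ∷ 12 ∷ 13 ∷ 14 ∷ 15 ∷ 10 ∷ 11 ∷ 8 ∷ 9 ∷ 4 ∷ 5 ∷ 6 ∷ 7 ∷ [] , 5 ∷ 4 ∷ 6 ∷ 5 ∷ 2 ∷ 1 ∷ 1 ∷ 0 ∷ 4 ∷ 3 ∷ 5 ∷ 4 ∷ 3 ∷ 2 ∷ 2 ∷ 1 ∷ [])
  ∷ (2 ∷ 5 ∷ 0 ∷ 7 ∷ 6 ∷ 1 ∷ 4 ∷ 3 ∷ 9 ∷ 8 ∷ 11 ∷ 10 ∷ 13 ∷ 12 ∷ 15 ∷ 14 ∷ [] , 7 ∷ 4 ∷ 8 ∷ 3 ∷ 6 ∷ 5 ∷ 7 ∷ 4 ∷ 2 ∷ 3 ∷ 1 ∷ 2 ∷ 1 ∷ 2 ∷ 0 ∷ 1 ∷ [])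
  ∷ (2 ∷ 5 ∷ 0 ∷ 7 ∷ 6 ∷ 1 ∷ 4 ∷ 3 ∷ 9 ∷ 8 ∷ 11 ∷ 10 ∷ 14 ∷ 15 ∷ 12 ∷ 13 ∷ [] , 9 ∷ 6 ∷ 10 ∷ 5 ∷ 8 ∷ 7 ∷ 9 ∷ 6 ∷ 4 ∷ 5 ∷ 3 ∷ 4 ∷ 1 ∷ 0 ∷ 2 ∷ 1 ∷ [])
  ∷ (2 ∷ 5 ∷ 0 ∷ 7 ∷ 6 ∷ 1 ∷ 4 ∷ 3 ∷ 9 ∷ 8 ∷ 14 ∷ 15 ∷ 13 ∷ 12 ∷ 10 ∷ 11 ∷ [] , 9 ∷ 6 ∷ 10 ∷ 1 ∷ 8 ∷ 7 ∷ 9 ∷ 2 ∷ 4 ∷ 5 ∷ 1 ∷ 0 ∷ 3 ∷ 4 ∷ 2 ∷ 1 ∷ [])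
  ∷ (2 ∷ 5 ∷ 0 ∷ 7 ∷ 6 ∷ 1 ∷ 4 ∷ 3 ∷ 10 ∷ 11 ∷ 8 ∷ 9 ∷ 13 ∷ 12 ∷ 15 ∷ 14 ∷ [] , 9 ∷ 6 ∷ 10 ∷ 5 ∷ 8 ∷ 7 ∷ 9 ∷ 6 ∷ 4 ∷ 3 ∷ 5 ∷ 4 ∷ 1 ∷ 2 ∷ 0 ∷ 1 ∷ [])
  ∷ (2 ∷ 5 ∷ 0 ∷ 7 ∷ 6 ∷ 1 ∷ 4 ∷ 3 ∷ 10 ∷ 11 ∷ 8 ∷ 9 ∷ 14 ∷ 15 ∷ 12 ∷ 13 ∷ [] , 7 ∷ 4 ∷ 8 ∷ 3 ∷ 6 ∷ 5 ∷ 7 ∷ 4 ∷ 2 ∷ 1 ∷ 3 ∷ 2 ∷ 1 ∷ 0 ∷ 2 ∷ 1 ∷ [])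
  ∷ (2 ∷ 5 ∷ 0 ∷ 7 ∷ 6 ∷ 1 ∷ 4 ∷ 3 ∷ 10 ∷ 13 ∷ 8 ∷ 15 ∷ 14 ∷ 9 ∷ 12 ∷ 11 ∷ [] , 5 ∷ 2 ∷ 6 ∷ 1 ∷ 4 ∷ 3 ∷ 5 ∷ 2 ∷ 4 ∷ 1 ∷ 5 ∷ 0 ∷ 3 ∷ 2 ∷ 4 ∷ 1 ∷ [])
  ∷ (2 ∷ 5 ∷ 0 ∷ 7 ∷ 6 ∷ 1 ∷ 4 ∷ 3 ∷ 12 ∷ 11 ∷ 14 ∷ 9 ∷ 8 ∷ 15 ∷ 10 ∷ 13 ∷ [] , 7 ∷ 4 ∷ 8 ∷ 3 ∷ 6 ∷ 5 ∷ 7 ∷ 4 ∷ 4 ∷ 1 ∷ 3 ∷ 2 ∷ 5 ∷ 0 ∷ 4 ∷ 1 ∷ [])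
  ∷ (2 ∷ 5 ∷ 0 ∷ 7 ∷ 6 ∷ 1 ∷ 4 ∷ 3 ∷ 12 ∷ 13 ∷ 11 ∷ 10 ∷ 8 ∷ 9 ∷ 15 ∷ 14 ∷ [] , 7 ∷ 4 ∷ 8 ∷ 3 ∷ 6 ∷ 5 ∷ 7 ∷ 4 ∷ 4 ∷ 3 ∷ 1 ∷ 2 ∷ 5 ∷ 4 ∷ 0 ∷ 1 ∷ [])
  ∷ (2 ∷ 5 ∷ 0 ∷ 7 ∷ 6 ∷ 1 ∷ 4 ∷ 3 ∷ 12 ∷ 13 ∷ 14 ∷ 15 ∷ 8 ∷ 9 ∷ 10 ∷ 11 ∷ [] , 5 ∷ 2 ∷ 6 ∷ 1 ∷ 4 ∷ 3 ∷ 5 ∷ 2 ∷ 2 ∷ 1 ∷ 1 ∷ 0 ∷ 3 ∷ 2 ∷ 2 ∷ 1 ∷ [])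
  ∷ (2 ∷ 5 ∷ 0 ∷ 7 ∷ 12 ∷ 1 ∷ 14 ∷ 3 ∷ 10 ∷ 11 ∷ 8 ∷ 9 ∷ 4 ∷ 15 ∷ 6 ∷ 13 ∷ [] , 9 ∷ 4 ∷ 10 ∷ 3 ∷ 6 ∷ 5 ∷ 5 ∷ 4 ∷ 8 ∷ 1 ∷ 9 ∷ 2 ∷ 7 ∷ 0 ∷ 6 ∷ 1 ∷ [])
  ∷ (2 ∷ 5 ∷ 0 ∷ 7 ∷ 12 ∷ 1 ∷ 14 ∷ 3 ∷ 10 ∷ 13 ∷ 8 ∷ 15 ∷ 4 ∷ 9 ∷ 6 ∷ 11 ∷ [] , 7 ∷ 2 ∷ 8 ∷ 1 ∷ 4 ∷ 3 ∷ 3 ∷ 2 ∷ 6 ∷ 1 ∷ 7 ∷ 0 ∷ 5 ∷ 2 ∷ 4 ∷ 1 ∷ [])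
  ∷ (2 ∷ 5 ∷ 0 ∷ 11 ∷ 6 ∷ 1 ∷ 4 ∷ 15 ∷ 9 ∷ 8 ∷ 14 ∷ 3 ∷ 13 ∷ 12 ∷ 10 ∷ 7 ∷ [] , 11 ∷ 8 ∷ 12 ∷ 1 ∷ 10 ∷ 9 ∷ 11 ∷ 0 ∷ 6 ∷ 7 ∷ 3 ∷ 2 ∷ 5 ∷ 6 ∷ 4 ∷ 1 ∷ [])
  ∷ (2 ∷ 5 ∷ 0 ∷ 11 ∷ 6 ∷ 1 ∷ 4 ∷ 15 ∷ 10 ∷ 13 ∷ 8 ∷ 3 ∷ 14 ∷ 9 ∷ 12 ∷ 7 ∷ [] , 7 ∷ 4 ∷ 8 ∷ 1 ∷ 6 ∷ 5 ∷ 7 ∷ 0 ∷ 6 ∷ 3 ∷ 7 ∷ 2 ∷ 5 ∷ 4 ∷ 6 ∷ 1 ∷ [])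
  ∷ (2 ∷ 5 ∷ 0 ∷ 11 ∷ 6 ∷ 1 ∷ 4 ∷ 15 ∷ 12 ∷ 13 ∷ 14 ∷ 3 ∷ 8 ∷ 9 ∷ 10 ∷ 7 ∷ [] , 7 ∷ 4 ∷ 8 ∷ 1 ∷ 6 ∷ 5 ∷ 7 ∷ 0 ∷ 4 ∷ 3 ∷ 3 ∷ 2 ∷ 5 ∷ 4 ∷ 4 ∷ 1 ∷ [])
  ∷ (2 ∷ 5 ∷ 0 ∷ 11 ∷ 12 ∷ 1 ∷ 7 ∷ 6 ∷ 10 ∷ 13 ∷ 8 ∷ 3 ∷ 4 ∷ 9 ∷ 15 ∷ 14 ∷ [] , 11 ∷ 6 ∷ 12 ∷ 3 ∷ 8 ∷ 7 ∷ 1 ∷ 2 ∷ 10 ∷ 5 ∷ 11 ∷ 4 ∷ 9 ∷ 6 ∷ 0 ∷ 1 ∷ [])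
  ∷ (2 ∷ 5 ∷ 0 ∷ 11 ∷ 12 ∷ 1 ∷ 14 ∷ 15 ∷ 10 ∷ 13 ∷ 8 ∷ 3 ∷ 4 ∷ 9 ∷ 6 ∷ 7 ∷ [] , 9 ∷ 4 ∷ 10 ∷ 1 ∷ 6 ∷ 5 ∷ 1 ∷ 0 ∷ 8 ∷ 3 ∷ 9 ∷ 2 ∷ 7 ∷ 4 ∷ 2 ∷ 1 ∷ [])
  ∷ (2 ∷ 9 ∷ 0 ∷ 7 ∷ 5 ∷ 4 ∷ 14 ∷ 3 ∷ 10 ∷ 1 ∷ 8 ∷ 15 ∷ 13 ∷ 12 ∷ 6 ∷ 11 ∷ [] , 11 ∷ 8 ∷ 12 ∷ 1 ∷ 6 ∷ 7 ∷ 3 ∷ 2 ∷ 10 ∷ 9 ∷ 11 ∷ 0 ∷ 5 ∷ 6 ∷ 4 ∷ 1 ∷ [])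
  ∷ (2 ∷ 9 ∷ 0 ∷ 7 ∷ 6 ∷ 13 ∷ 4 ∷ 3 ∷ 10 ∷ 1 ∷ 8 ∷ 15 ∷ 14 ∷ 5 ∷ 12 ∷ 11 ∷ [] , 7 ∷ 4 ∷ 8 ∷ 1 ∷ 6 ∷ 3 ∷ 7 ∷ 2 ∷ 6 ∷ 5 ∷ 7 ∷ 0 ∷ 5 ∷ 4 ∷ 6 ∷ 1 ∷ [])
  ∷ (2 ∷ 9 ∷ 0 ∷ 7 ∷ 6 ∷ 13 ∷ 4 ∷ 3 ∷ 12 ∷ 1 ∷ 11 ∷ 10 ∷ 8 ∷ 5 ∷ 15 ∷ 14 ∷ [] , 11 ∷ 6 ∷ 12 ∷ 3 ∷ 10 ∷ 5 ∷ 11 ∷ 4 ∷ 8 ∷ 7 ∷ 1 ∷ 2 ∷ 9 ∷ 6 ∷ 0 ∷ 1 ∷ [])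
  ∷ (2 ∷ 9 ∷ 0 ∷ 7 ∷ 6 ∷ 13 ∷ 4 ∷ 3 ∷ 12 ∷ 1 ∷ 14 ∷ 15 ∷ 8 ∷ 5 ∷ 10 ∷ 11 ∷ [] , 9 ∷ 4 ∷ 10 ∷ 1 ∷ 8 ∷ 3 ∷ 9 ∷ 2 ∷ 6 ∷ 5 ∷ 1 ∷ 0 ∷ 7 ∷ 4 ∷ 2 ∷ 1 ∷ [])
  ∷ (2 ∷ 9 ∷ 0 ∷ 7 ∷ 12 ∷ 13 ∷ 14 ∷ 3 ∷ 10 ∷ 1 ∷ 8 ∷ 15 ∷ 4 ∷ 5 ∷ 6 ∷ 11 ∷ [] , 7 ∷ 4 ∷ 8 ∷ 1 ∷ 4 ∷ 3 ∷ 3 ∷ 2 ∷ 6 ∷ 5 ∷ 7 ∷ 0 ∷ 5 ∷ 4 ∷ 4 ∷ 1 ∷ [])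
  ∷ (2 ∷ 9 ∷ 0 ∷ 11 ∷ 5 ∷ 4 ∷ 7 ∷ 6 ∷ 10 ∷ 1 ∷ 8 ∷ 3 ∷ 13 ∷ 12 ∷ 15 ∷ 14 ∷ [] , 7 ∷ 4 ∷ 8 ∷ 3 ∷ 2 ∷ 3 ∷ 1 ∷ 2 ∷ 6 ∷ 5 ∷ 7 ∷ 4 ∷ 1 ∷ 2 ∷ 0 ∷ 1 ∷ [])
  ∷ (2 ∷ 9 ∷ 0 ∷ 11 ∷ 5 ∷ 4 ∷ 7 ∷ 6 ∷ 10 ∷ 1 ∷ 8 ∷ 3 ∷ 14 ∷ 15 ∷ 12 ∷ 13 ∷ [] , 9 ∷ 6 ∷ 10 ∷ 5 ∷ 4 ∷ 5 ∷ 3 ∷ 4 ∷ 8 ∷ 7 ∷ 9 ∷ 6 ∷ 1 ∷ 0 ∷ 2 ∷ 1 ∷ [])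
  ∷ (2 ∷ 9 ∷ 0 ∷ 11 ∷ 5 ∷ 4 ∷ 14 ∷ 15 ∷ 10 ∷ 1 ∷ 8 ∷ 3 ∷ 13 ∷ 12 ∷ 6 ∷ 7 ∷ [] , 9 ∷ 6 ∷ 10 ∷ 1 ∷ 4 ∷ 5 ∷ 1 ∷ 0 ∷ 8 ∷ 7 ∷ 9 ∷ 2 ∷ 3 ∷ 4 ∷ 2 ∷ 1 ∷ [])
  ∷ (2 ∷ 9 ∷ 0 ∷ 11 ∷ 6 ∷ 7 ∷ 4 ∷ 5 ∷ 10 ∷ 1 ∷ 8 ∷ 3 ∷ 13 ∷ 12 ∷ 15 ∷ 14 ∷ [] , 9 ∷ 6 ∷ 10 ∷ 5 ∷ 4 ∷ 3 ∷ 5 ∷ 4 ∷ 8 ∷ 7 ∷ 9 ∷ 6 ∷ 1 ∷ 2 ∷ 0 ∷ 1 ∷ [])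
  ∷ (2 ∷ 9 ∷ 0 ∷ 11 ∷ 6 ∷ 7 ∷ 4 ∷ 5 ∷ 10 ∷ 1 ∷ 8 ∷ 3 ∷ 14 ∷ 15 ∷ 12 ∷ 13 ∷ [] , 7 ∷ 4 ∷ 8 ∷ 3 ∷ 2 ∷ 1 ∷ 3 ∷ 2 ∷ 6 ∷ 5 ∷ 7 ∷ 4 ∷ 1 ∷ 0 ∷ 2 ∷ 1 ∷ [])
  ∷ (2 ∷ 9 ∷ 0 ∷ 11 ∷ 6 ∷ 7 ∷ 4 ∷ 5 ∷ 12 ∷ 1 ∷ 14 ∷ 3 ∷ 8 ∷ 15 ∷ 10 ∷ 13 ∷ [] , 9 ∷ 4 ∷ 10 ∷ 3 ∷ 8 ∷ 1 ∷ 9 ∷ 2 ∷ 6 ∷ 5 ∷ 5 ∷ 4 ∷ 7 ∷ 0 ∷ 6 ∷ 1 ∷ [])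
  ∷ (2 ∷ 9 ∷ 0 ∷ 11 ∷ 6 ∷ 13 ∷ 4 ∷ 15 ∷ 10 ∷ 1 ∷ 8 ∷ 3 ∷ 14 ∷ 5 ∷ 12 ∷ 7 ∷ [] , 5 ∷ 2 ∷ 6 ∷ 1 ∷ 4 ∷ 1 ∷ 5 ∷ 0 ∷ 4 ∷ 3 ∷ 5 ∷ 2 ∷ 3 ∷ 2 ∷ 4 ∷ 1 ∷ [])
  ∷ (2 ∷ 9 ∷ 0 ∷ 11 ∷ 6 ∷ 13 ∷ 4 ∷ 15 ∷ 12 ∷ 1 ∷ 14 ∷ 3 ∷ 8 ∷ 5 ∷ 10 ∷ 7 ∷ [] , 7 ∷ 2 ∷ 8 ∷ 1 ∷ 6 ∷ 1 ∷ 7 ∷ 0 ∷ 4 ∷ 3 ∷ 3 ∷ 2 ∷ 5 ∷ 2 ∷ 4 ∷ 1 ∷ [])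
  ∷ (2 ∷ 9 ∷ 0 ∷ 11 ∷ 12 ∷ 7 ∷ 14 ∷ 5 ∷ 10 ∷ 1 ∷ 8 ∷ 3 ∷ 4 ∷ 15 ∷ 6 ∷ 13 ∷ [] , 7 ∷ 4 ∷ 8 ∷ 3 ∷ 4 ∷ 1 ∷ 3 ∷ 2 ∷ 6 ∷ 5 ∷ 7 ∷ 4 ∷ 5 ∷ 0 ∷ 4 ∷ 1 ∷ [])
  ∷ (2 ∷ 9 ∷ 0 ∷ 11 ∷ 12 ∷ 13 ∷ 7 ∷ 6 ∷ 10 ∷ 1 ∷ 8 ∷ 3 ∷ 4 ∷ 5 ∷ 15 ∷ 14 ∷ [] , 7 ∷ 4 ∷ 8 ∷ 3 ∷ 4 ∷ 3 ∷ 1 ∷ 2 ∷ 6 ∷ 5 ∷ 7 ∷ 4 ∷ 5 ∷ 4 ∷ 0 ∷ 1 ∷ [])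
  ∷ (2 ∷ 9 ∷ 0 ∷ 11 ∷ 12 ∷ 13 ∷ 14 ∷ 15 ∷ 10 ∷ 1 ∷ 8 ∷ 3 ∷ 4 ∷ 5 ∷ 6 ∷ 7 ∷ [] , 5 ∷ 2 ∷ 6 ∷ 1 ∷ 2 ∷ 1 ∷ 1 ∷ 0 ∷ 4 ∷ 3 ∷ 5 ∷ 2 ∷ 3 ∷ 2 ∷ 2 ∷ 1 ∷ [])
  ∷ (4 ∷ 3 ∷ 6 ∷ 1 ∷ 0 ∷ 7 ∷ 2 ∷ 5 ∷ 9 ∷ 8 ∷ 11 ∷ 10 ∷ 13 ∷ 12 ∷ 15 ∷ 14 ∷ [] , 7 ∷ 4 ∷ 6 ∷ 5 ∷ 8 ∷ 3 ∷ 7 ∷ 4 ∷ 2 ∷ 3 ∷ 1 ∷ 2 ∷ 1 ∷ 2 ∷ 0 ∷ 1 ∷ [])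
  ∷ (4 ∷ 3 ∷ 6 ∷ 1 ∷ 0 ∷ 7 ∷ 2 ∷ 5 ∷ 9 ∷ 8 ∷ 11 ∷ 10 ∷ 14 ∷ 15 ∷ 12 ∷ 13 ∷ [] , 9 ∷ 6 ∷ 8 ∷ 7 ∷ 10 ∷ 1 ∷ 9 ∷ 2 ∷ 4 ∷ 5 ∷ 3 ∷ 4 ∷ 1 ∷ 0 ∷ 2 ∷ 1 ∷ [])
  ∷ (4 ∷ 3 ∷ 6 ∷ 1 ∷ 0 ∷ 7 ∷ 2 ∷ 5 ∷ 9 ∷ 8 ∷ 14 ∷ 15 ∷ 13 ∷ 12 ∷ 10 ∷ 11 ∷ [] , 9 ∷ 6 ∷ 8 ∷ 7 ∷ 10 ∷ 5 ∷ 9 ∷ 6 ∷ 4 ∷ 5 ∷ 1 ∷ 0 ∷ 3 ∷ 4 ∷ 2 ∷ 1 ∷ [])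
  ∷ (4 ∷ 3 ∷ 6 ∷ 1 ∷ 0 ∷ 7 ∷ 2 ∷ 5 ∷ 10 ∷ 11 ∷ 8 ∷ 9 ∷ 13 ∷ 12 ∷ 15 ∷ 14 ∷ [] , 7 ∷ 4 ∷ 6 ∷ 5 ∷ 8 ∷ 3 ∷ 7 ∷ 4 ∷ 4 ∷ 3 ∷ 5 ∷ 4 ∷ 1 ∷ 2 ∷ 0 ∷ 1 ∷ [])
  ∷ (4 ∷ 3 ∷ 6 ∷ 1 ∷ 0 ∷ 7 ∷ 2 ∷ 5 ∷ 10 ∷ 11 ∷ 8 ∷ 9 ∷ 14 ∷ 15 ∷ 12 ∷ 13 ∷ [] , 5 ∷ 2 ∷ 4 ∷ 3 ∷ 6 ∷ 1 ∷ 5 ∷ 2 ∷ 2 ∷ 1 ∷ 3 ∷ 2 ∷ 1 ∷ 0 ∷ 2 ∷ 1 ∷ [])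
  ∷ (4 ∷ 3 ∷ 6 ∷ 1 ∷ 0 ∷ 7 ∷ 2 ∷ 5 ∷ 10 ∷ 13 ∷ 8 ∷ 15 ∷ 14 ∷ 9 ∷ 12 ∷ 11 ∷ [] , 7 ∷ 4 ∷ 6 ∷ 5 ∷ 8 ∷ 3 ∷ 7 ∷ 4 ∷ 4 ∷ 1 ∷ 5 ∷ 0 ∷ 3 ∷ 2 ∷ 4 ∷ 1 ∷ [])
  ∷ (4 ∷ 3 ∷ 6 ∷ 1 ∷ 0 ∷ 7 ∷ 2 ∷ 5 ∷ 12 ∷ 11 ∷ 14 ∷ 9 ∷ 8 ∷ 15 ∷ 10 ∷ 13 ∷ [] , 5 ∷ 2 ∷ 4 ∷ 3 ∷ 6 ∷ 1 ∷ 5 ∷ 2 ∷ 4 ∷ 1 ∷ 3 ∷ 2 ∷ 5 ∷ 0 ∷ 4 ∷ 1 ∷ [])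
  ∷ (4 ∷ 3 ∷ 6 ∷ 1 ∷ 0 ∷ 7 ∷ 2 ∷ 5 ∷ 12 ∷ 13 ∷ 11 ∷ 10 ∷ 8 ∷ 9 ∷ 15 ∷ 14 ∷ [] , 9 ∷ 6 ∷ 8 ∷ 7 ∷ 10 ∷ 5 ∷ 9 ∷ 6 ∷ 4 ∷ 3 ∷ 1 ∷ 2 ∷ 5 ∷ 4 ∷ 0 ∷ 1 ∷ [])
  ∷ (4 ∷ 3 ∷ 6 ∷ 1 ∷ 0 ∷ 7 ∷ 2 ∷ 5 ∷ 12 ∷ 13 ∷ 14 ∷ 15 ∷ 8 ∷ 9 ∷ 10 ∷ 11 ∷ [] , 7 ∷ 4 ∷ 6 ∷ 5 ∷ 8 ∷ 3 ∷ 7 ∷ 4 ∷ 2 ∷ 1 ∷ 1 ∷ 0 ∷ 3 ∷ 2 ∷ 2 ∷ 1 ∷ [])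
  ∷ (4 ∷ 3 ∷ 6 ∷ 1 ∷ 0 ∷ 13 ∷ 2 ∷ 15 ∷ 9 ∷ 8 ∷ 11 ∷ 10 ∷ 14 ∷ 5 ∷ 12 ∷ 7 ∷ [] , 11 ∷ 8 ∷ 10 ∷ 9 ∷ 12 ∷ 1 ∷ 11 ∷ 0 ∷ 6 ∷ 7 ∷ 5 ∷ 6 ∷ 3 ∷ 2 ∷ 4 ∷ 1 ∷ [])
  ∷ (4 ∷ 3 ∷ 6 ∷ 1 ∷ 0 ∷ 13 ∷ 2 ∷ 15 ∷ 10 ∷ 11 ∷ 8 ∷ 9 ∷ 14 ∷ 5 ∷ 12 ∷ 7 ∷ [] , 7 ∷ 4 ∷ 6 ∷ 5 ∷ 8 ∷ 1 ∷ 7 ∷ 0 ∷ 4 ∷ 3 ∷ 5 ∷ 4 ∷ 3 ∷ 2 ∷ 4 ∷ 1 ∷ [])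
  ∷ (4 ∷ 3 ∷ 6 ∷ 1 ∷ 0 ∷ 13 ∷ 2 ∷ 15 ∷ 12 ∷ 11 ∷ 14 ∷ 9 ∷ 8 ∷ 5 ∷ 10 ∷ 7 ∷ [] , 7 ∷ 4 ∷ 6 ∷ 5 ∷ 8 ∷ 1 ∷ 7 ∷ 0 ∷ 6 ∷ 3 ∷ 5 ∷ 4 ∷ 7 ∷ 2 ∷ 6 ∷ 1 ∷ [])
  ∷ (4 ∷ 3 ∷ 10 ∷ 1 ∷ 0 ∷ 7 ∷ 14 ∷ 5 ∷ 12 ∷ 11 ∷ 2 ∷ 9 ∷ 8 ∷ 15 ∷ 6 ∷ 13 ∷ [] , 7 ∷ 2 ∷ 4 ∷ 3 ∷ 8 ∷ 1 ∷ 3 ∷ 2 ∷ 6 ∷ 1 ∷ 5 ∷ 2 ∷ 7 ∷ 0 ∷ 4 ∷ 1 ∷ [])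
  ∷ (4 ∷ 3 ∷ 10 ∷ 1 ∷ 0 ∷ 7 ∷ 14 ∷ 5 ∷ 12 ∷ 13 ∷ 2 ∷ 15 ∷ 8 ∷ 9 ∷ 6 ∷ 11 ∷ [] , 9 ∷ 4 ∷ 6 ∷ 5 ∷ 10 ∷ 3 ∷ 5 ∷ 4 ∷ 8 ∷ 1 ∷ 7 ∷ 0 ∷ 9 ∷ 2 ∷ 6 ∷ 1 ∷ [])
  ∷ (4 ∷ 3 ∷ 10 ∷ 1 ∷ 0 ∷ 13 ∷ 7 ∷ 6 ∷ 12 ∷ 11 ∷ 2 ∷ 9 ∷ 8 ∷ 5 ∷ 15 ∷ 14 ∷ [] , 11 ∷ 6 ∷ 8 ∷ 7 ∷ 12 ∷ 3 ∷ 1 ∷ 2 ∷ 10 ∷ 5 ∷ 9 ∷ 6 ∷ 11 ∷ 4 ∷ 0 ∷ 1 ∷ [])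
  ∷ (4 ∷ 3 ∷ 10 ∷ 1 ∷ 0 ∷ 13 ∷ 14 ∷ 15 ∷ 12 ∷ 11 ∷ 2 ∷ 9 ∷ 8 ∷ 5 ∷ 6 ∷ 7 ∷ [] , 9 ∷ 4 ∷ 6 ∷ 5 ∷ 10 ∷ 1 ∷ 1 ∷ 0 ∷ 8 ∷ 3 ∷ 7 ∷ 4 ∷ 9 ∷ 2 ∷ 2 ∷ 1 ∷ [])
  ∷ (4 ∷ 5 ∷ 3 ∷ 2 ∷ 0 ∷ 1 ∷ 7 ∷ 6 ∷ 9 ∷ 8 ∷ 11 ∷ 10 ∷ 13 ∷ 12 ∷ 15 ∷ 14 ∷ [] , 5 ∷ 4 ∷ 2 ∷ 3 ∷ 6 ∷ 5 ∷ 1 ∷ 2 ∷ 2 ∷ 3 ∷ 1 ∷ 2 ∷ 1 ∷ 2 ∷ 0 ∷ 1 ∷ [])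
  ∷ (4 ∷ 5 ∷ 3 ∷ 2 ∷ 0 ∷ 1 ∷ 7 ∷ 6 ∷ 9 ∷ 8 ∷ 11 ∷ 10 ∷ 14 ∷ 15 ∷ 12 ∷ 13 ∷ [] , 7 ∷ 6 ∷ 4 ∷ 5 ∷ 8 ∷ 7 ∷ 3 ∷ 4 ∷ 4 ∷ 5 ∷ 3 ∷ 4 ∷ 1 ∷ 0 ∷ 2 ∷ 1 ∷ [])
  ∷ (4 ∷ 5 ∷ 3 ∷ 2 ∷ 0 ∷ 1 ∷ 7 ∷ 6 ∷ 9 ∷ 8 ∷ 14 ∷ 15 ∷ 13 ∷ 12 ∷ 10 ∷ 11 ∷ [] , 7 ∷ 6 ∷ 4 ∷ 5 ∷ 8 ∷ 7 ∷ 3 ∷ 4 ∷ 4 ∷ 5 ∷ 1 ∷ 0 ∷ 3 ∷ 4 ∷ 2 ∷ 1 ∷ [])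
  ∷ (4 ∷ 5 ∷ 3 ∷ 2 ∷ 0 ∷ 1 ∷ 7 ∷ 6 ∷ 10 ∷ 11 ∷ 8 ∷ 9 ∷ 13 ∷ 12 ∷ 15 ∷ 14 ∷ [] , 9 ∷ 8 ∷ 6 ∷ 7 ∷ 10 ∷ 9 ∷ 1 ∷ 2 ∷ 4 ∷ 3 ∷ 5 ∷ 4 ∷ 1 ∷ 2 ∷ 0 ∷ 1 ∷ [])
  ∷ (4 ∷ 5 ∷ 3 ∷ 2 ∷ 0 ∷ 1 ∷ 7 ∷ 6 ∷ 10 ∷ 11 ∷ 8 ∷ 9 ∷ 14 ∷ 15 ∷ 12 ∷ 13 ∷ [] , 7 ∷ 6 ∷ 4 ∷ 5 ∷ 8 ∷ 7 ∷ 3 ∷ 4 ∷ 2 ∷ 1 ∷ 3 ∷ 2 ∷ 1 ∷ 0 ∷ 2 ∷ 1 ∷ [])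
  ∷ (4 ∷ 5 ∷ 3 ∷ 2 ∷ 0 ∷ 1 ∷ 7 ∷ 6 ∷ 10 ∷ 13 ∷ 8 ∷ 15 ∷ 14 ∷ 9 ∷ 12 ∷ 11 ∷ [] , 9 ∷ 8 ∷ 6 ∷ 7 ∷ 10 ∷ 9 ∷ 5 ∷ 6 ∷ 4 ∷ 1 ∷ 5 ∷ 0 ∷ 3 ∷ 2 ∷ 4 ∷ 1 ∷ [])
  ∷ (4 ∷ 5 ∷ 3 ∷ 2 ∷ 0 ∷ 1 ∷ 7 ∷ 6 ∷ 12 ∷ 11 ∷ 14 ∷ 9 ∷ 8 ∷ 15 ∷ 10 ∷ 13 ∷ [] , 9 ∷ 8 ∷ 6 ∷ 7 ∷ 10 ∷ 9 ∷ 5 ∷ 6 ∷ 4 ∷ 1 ∷ 3 ∷ 2 ∷ 5 ∷ 0 ∷ 4 ∷ 1 ∷ [])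
  ∷ (4 ∷ 5 ∷ 3 ∷ 2 ∷ 0 ∷ 1 ∷ 7 ∷ 6 ∷ 12 ∷ 13 ∷ 11 ∷ 10 ∷ 8 ∷ 9 ∷ 15 ∷ 14 ∷ [] , 5 ∷ 4 ∷ 2 ∷ 3 ∷ 6 ∷ 5 ∷ 1 ∷ 2 ∷ 4 ∷ 3 ∷ 1 ∷ 2 ∷ 5 ∷ 4 ∷ 0 ∷ 1 ∷ [])
  ∷ (4 ∷ 5 ∷ 3 ∷ 2 ∷ 0 ∷ 1 ∷ 7 ∷ 6 ∷ 12 ∷ 13 ∷ 14 ∷ 15 ∷ 8 ∷ 9 ∷ 10 ∷ 11 ∷ [] , 7 ∷ 6 ∷ 4 ∷ 5 ∷ 8 ∷ 7 ∷ 3 ∷ 4 ∷ 2 ∷ 1 ∷ 1 ∷ 0 ∷ 3 ∷ 2 ∷ 2 ∷ 1 ∷ [])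
  ∷ (4 ∷ 5 ∷ 3 ∷ 2 ∷ 0 ∷ 1 ∷ 14 ∷ 15 ∷ 9 ∷ 8 ∷ 11 ∷ 10 ∷ 13 ∷ 12 ∷ 6 ∷ 7 ∷ [] , 7 ∷ 6 ∷ 4 ∷ 5 ∷ 8 ∷ 7 ∷ 1 ∷ 0 ∷ 4 ∷ 5 ∷ 3 ∷ 4 ∷ 3 ∷ 4 ∷ 2 ∷ 1 ∷ [])
  ∷ (4 ∷ 5 ∷ 3 ∷ 2 ∷ 0 ∷ 1 ∷ 14 ∷ 15 ∷ 10 ∷ 11 ∷ 8 ∷ 9 ∷ 13 ∷ 12 ∷ 6 ∷ 7 ∷ [] , 11 ∷ 10 ∷ 8 ∷ 9 ∷ 12 ∷ 11 ∷ 1 ∷ 0 ∷ 6 ∷ 5 ∷ 7 ∷ 6 ∷ 3 ∷ 4 ∷ 2 ∷ 1 ∷ [])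
  ∷ (4 ∷ 5 ∷ 3 ∷ 2 ∷ 0 ∷ 1 ∷ 14 ∷ 15 ∷ 12 ∷ 13 ∷ 11 ∷ 10 ∷ 8 ∷ 9 ∷ 6 ∷ 7 ∷ [] , 7 ∷ 6 ∷ 4 ∷ 5 ∷ 8 ∷ 7 ∷ 1 ∷ 0 ∷ 6 ∷ 5 ∷ 3 ∷ 4 ∷ 7 ∷ 6 ∷ 2 ∷ 1 ∷ [])
  ∷ (4 ∷ 5 ∷ 6 ∷ 7 ∷ 0 ∷ 1 ∷ 2 ∷ 3 ∷ 9 ∷ 8 ∷ 11 ∷ 10 ∷ 13 ∷ 12 ∷ 15 ∷ 14 ∷ [] , 5 ∷ 4 ∷ 4 ∷ 3 ∷ 6 ∷ 5 ∷ 5 ∷ 4 ∷ 2 ∷ 3 ∷ 1 ∷ 2 ∷ 1 ∷ 2 ∷ 0 ∷ 1 ∷ [])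
  ∷ (4 ∷ 5 ∷ 6 ∷ 7 ∷ 0 ∷ 1 ∷ 2 ∷ 3 ∷ 9 ∷ 8 ∷ 11 ∷ 10 ∷ 14 ∷ 15 ∷ 12 ∷ 13 ∷ [] , 7 ∷ 6 ∷ 6 ∷ 5 ∷ 8 ∷ 7 ∷ 7 ∷ 6 ∷ 4 ∷ 5 ∷ 3 ∷ 4 ∷ 1 ∷ 0 ∷ 2 ∷ 1 ∷ [])
  ∷ (4 ∷ 5 ∷ 6 ∷ 7 ∷ 0 ∷ 1 ∷ 2 ∷ 3 ∷ 9 ∷ 8 ∷ 14 ∷ 15 ∷ 13 ∷ 12 ∷ 10 ∷ 11 ∷ [] , 7 ∷ 6 ∷ 2 ∷ 1 ∷ 8 ∷ 7 ∷ 3 ∷ 2 ∷ 4 ∷ 5 ∷ 1 ∷ 0 ∷ 3 ∷ 4 ∷ 2 ∷ 1 ∷ [])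
  ∷ (4 ∷ 5 ∷ 6 ∷ 7 ∷ 0 ∷ 1 ∷ 2 ∷ 3 ∷ 10 ∷ 11 ∷ 8 ∷ 9 ∷ 13 ∷ 12 ∷ 15 ∷ 14 ∷ [] , 7 ∷ 6 ∷ 6 ∷ 5 ∷ 8 ∷ 7 ∷ 7 ∷ 6 ∷ 4 ∷ 3 ∷ 5 ∷ 4 ∷ 1 ∷ 2 ∷ 0 ∷ 1 ∷ [])
  ∷ (4 ∷ 5 ∷ 6 ∷ 7 ∷ 0 ∷ 1 ∷ 2 ∷ 3 ∷ 10 ∷ 11 ∷ 8 ∷ 9 ∷ 14 ∷ 15 ∷ 12 ∷ 13 ∷ [] , 5 ∷ 4 ∷ 4 ∷ 3 ∷ 6 ∷ 5 ∷ 5 ∷ 4 ∷ 2 ∷ 1 ∷ 3 ∷ 2 ∷ 1 ∷ 0 ∷ 2 ∷ 1 ∷ [])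
  ∷ (4 ∷ 5 ∷ 6 ∷ 7 ∷ 0 ∷ 1 ∷ 2 ∷ 3 ∷ 10 ∷ 13 ∷ 8 ∷ 15 ∷ 14 ∷ 9 ∷ 12 ∷ 11 ∷ [] , 7 ∷ 2 ∷ 6 ∷ 1 ∷ 8 ∷ 3 ∷ 7 ∷ 2 ∷ 4 ∷ 1 ∷ 5 ∷ 0 ∷ 3 ∷ 2 ∷ 4 ∷ 1 ∷ [])
  ∷ (4 ∷ 5 ∷ 6 ∷ 7 ∷ 0 ∷ 1 ∷ 2 ∷ 3 ∷ 12 ∷ 11 ∷ 14 ∷ 9 ∷ 8 ∷ 15 ∷ 10 ∷ 13 ∷ [] , 5 ∷ 4 ∷ 4 ∷ 3 ∷ 6 ∷ 5 ∷ 5 ∷ 4 ∷ 4 ∷ 1 ∷ 3 ∷ 2 ∷ 5 ∷ 0 ∷ 4 ∷ 1 ∷ [])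
  ∷ (4 ∷ 5 ∷ 6 ∷ 7 ∷ 0 ∷ 1 ∷ 2 ∷ 3 ∷ 12 ∷ 13 ∷ 11 ∷ 10 ∷ 8 ∷ 9 ∷ 15 ∷ 14 ∷ [] , 5 ∷ 4 ∷ 4 ∷ 3 ∷ 6 ∷ 5 ∷ 5 ∷ 4 ∷ 4 ∷ 3 ∷ 1 ∷ 2 ∷ 5 ∷ 4 ∷ 0 ∷ 1 ∷ [])
  ∷ (4 ∷ 5 ∷ 6 ∷ 7 ∷ 0 ∷ 1 ∷ 2 ∷ 3 ∷ 12 ∷ 13 ∷ 14 ∷ 15 ∷ 8 ∷ 9 ∷ 10 ∷ 11 ∷ [] , 3 ∷ 2 ∷ 2 ∷ 1 ∷ 4 ∷ 3 ∷ 3 ∷ 2 ∷ 2 ∷ 1 ∷ 1 ∷ 0 ∷ 3 ∷ 2 ∷ 2 ∷ 1 ∷ [])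
  ∷ (4 ∷ 5 ∷ 6 ∷ 11 ∷ 0 ∷ 1 ∷ 2 ∷ 15 ∷ 9 ∷ 8 ∷ 14 ∷ 3 ∷ 13 ∷ 12 ∷ 10 ∷ 7 ∷ [] , 9 ∷ 8 ∷ 4 ∷ 1 ∷ 10 ∷ 9 ∷ 5 ∷ 0 ∷ 6 ∷ 7 ∷ 3 ∷ 2 ∷ 5 ∷ 6 ∷ 4 ∷ 1 ∷ [])
  ∷ (4 ∷ 5 ∷ 6 ∷ 11 ∷ 0 ∷ 1 ∷ 2 ∷ 15 ∷ 10 ∷ 13 ∷ 8 ∷ 3 ∷ 14 ∷ 9 ∷ 12 ∷ 7 ∷ [] , 9 ∷ 4 ∷ 8 ∷ 1 ∷ 10 ∷ 5 ∷ 9 ∷ 0 ∷ 6 ∷ 3 ∷ 7 ∷ 2 ∷ 5 ∷ 4 ∷ 6 ∷ 1 ∷ [])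
  ∷ (4 ∷ 5 ∷ 6 ∷ 11 ∷ 0 ∷ 1 ∷ 2 ∷ 15 ∷ 12 ∷ 13 ∷ 14 ∷ 3 ∷ 8 ∷ 9 ∷ 10 ∷ 7 ∷ [] , 5 ∷ 4 ∷ 4 ∷ 1 ∷ 6 ∷ 5 ∷ 5 ∷ 0 ∷ 4 ∷ 3 ∷ 3 ∷ 2 ∷ 5 ∷ 4 ∷ 4 ∷ 1 ∷ [])
  ∷ (4 ∷ 5 ∷ 10 ∷ 7 ∷ 0 ∷ 1 ∷ 14 ∷ 3 ∷ 9 ∷ 8 ∷ 2 ∷ 15 ∷ 13 ∷ 12 ∷ 6 ∷ 11 ∷ [] , 9 ∷ 8 ∷ 4 ∷ 1 ∷ 10 ∷ 9 ∷ 3 ∷ 2 ∷ 6 ∷ 7 ∷ 5 ∷ 0 ∷ 5 ∷ 6 ∷ 4 ∷ 1 ∷ [])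
  ∷ (4 ∷ 5 ∷ 10 ∷ 7 ∷ 0 ∷ 1 ∷ 14 ∷ 3 ∷ 12 ∷ 11 ∷ 2 ∷ 9 ∷ 8 ∷ 15 ∷ 6 ∷ 13 ∷ [] , 9 ∷ 4 ∷ 6 ∷ 3 ∷ 10 ∷ 5 ∷ 5 ∷ 4 ∷ 8 ∷ 1 ∷ 7 ∷ 2 ∷ 9 ∷ 0 ∷ 6 ∷ 1 ∷ [])
  ∷ (4 ∷ 5 ∷ 10 ∷ 7 ∷ 0 ∷ 1 ∷ 14 ∷ 3 ∷ 12 ∷ 13 ∷ 2 ∷ 15 ∷ 8 ∷ 9 ∷ 6 ∷ 11 ∷ [] , 7 ∷ 2 ∷ 4 ∷ 1 ∷ 8 ∷ 3 ∷ 3 ∷ 2 ∷ 6 ∷ 1 ∷ 5 ∷ 0 ∷ 7 ∷ 2 ∷ 4 ∷ 1 ∷ [])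
  ∷ (4 ∷ 5 ∷ 10 ∷ 11 ∷ 0 ∷ 1 ∷ 7 ∷ 6 ∷ 9 ∷ 8 ∷ 2 ∷ 3 ∷ 13 ∷ 12 ∷ 15 ∷ 14 ∷ [] , 9 ∷ 8 ∷ 4 ∷ 3 ∷ 10 ∷ 9 ∷ 1 ∷ 2 ∷ 6 ∷ 7 ∷ 5 ∷ 4 ∷ 1 ∷ 2 ∷ 0 ∷ 1 ∷ [])
  ∷ (4 ∷ 5 ∷ 10 ∷ 11 ∷ 0 ∷ 1 ∷ 7 ∷ 6 ∷ 9 ∷ 8 ∷ 2 ∷ 3 ∷ 14 ∷ 15 ∷ 12 ∷ 13 ∷ [] , 11 ∷ 10 ∷ 6 ∷ 5 ∷ 12 ∷ 11 ∷ 3 ∷ 4 ∷ 8 ∷ 9 ∷ 7 ∷ 6 ∷ 1 ∷ 0 ∷ 2 ∷ 1 ∷ [])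
  ∷ (4 ∷ 5 ∷ 10 ∷ 11 ∷ 0 ∷ 1 ∷ 7 ∷ 6 ∷ 12 ∷ 13 ∷ 2 ∷ 3 ∷ 8 ∷ 9 ∷ 15 ∷ 14 ∷ [] , 7 ∷ 6 ∷ 4 ∷ 3 ∷ 8 ∷ 7 ∷ 1 ∷ 2 ∷ 6 ∷ 5 ∷ 5 ∷ 4 ∷ 7 ∷ 6 ∷ 0 ∷ 1 ∷ [])
  ∷ (4 ∷ 5 ∷ 10 ∷ 11 ∷ 0 ∷ 1 ∷ 14 ∷ 15 ∷ 9 ∷ 8 ∷ 2 ∷ 3 ∷ 13 ∷ 12 ∷ 6 ∷ 7 ∷ [] , 7 ∷ 6 ∷ 2 ∷ 1 ∷ 8 ∷ 7 ∷ 1 ∷ 0 ∷ 4 ∷ 5 ∷ 3 ∷ 2 ∷ 3 ∷ 4 ∷ 2 ∷ 1 ∷ [])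
  ∷ (4 ∷ 5 ∷ 10 ∷ 11 ∷ 0 ∷ 1 ∷ 14 ∷ 15 ∷ 12 ∷ 13 ∷ 2 ∷ 3 ∷ 8 ∷ 9 ∷ 6 ∷ 7 ∷ [] , 5 ∷ 4 ∷ 2 ∷ 1 ∷ 6 ∷ 5 ∷ 1 ∷ 0 ∷ 4 ∷ 3 ∷ 3 ∷ 2 ∷ 5 ∷ 4 ∷ 2 ∷ 1 ∷ [])
  ∷ (4 ∷ 9 ∷ 3 ∷ 2 ∷ 0 ∷ 7 ∷ 14 ∷ 5 ∷ 12 ∷ 1 ∷ 11 ∷ 10 ∷ 8 ∷ 15 ∷ 6 ∷ 13 ∷ [] , 11 ∷ 8 ∷ 6 ∷ 7 ∷ 12 ∷ 1 ∷ 3 ∷ 2 ∷ 10 ∷ 9 ∷ 5 ∷ 6 ∷ 11 ∷ 0 ∷ 4 ∷ 1 ∷ [])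
  ∷ (4 ∷ 9 ∷ 3 ∷ 2 ∷ 0 ∷ 13 ∷ 7 ∷ 6 ∷ 12 ∷ 1 ∷ 11 ∷ 10 ∷ 8 ∷ 5 ∷ 15 ∷ 14 ∷ [] , 7 ∷ 4 ∷ 2 ∷ 3 ∷ 8 ∷ 3 ∷ 1 ∷ 2 ∷ 6 ∷ 5 ∷ 1 ∷ 2 ∷ 7 ∷ 4 ∷ 0 ∷ 1 ∷ [])
  ∷ (4 ∷ 9 ∷ 3 ∷ 2 ∷ 0 ∷ 13 ∷ 7 ∷ 6 ∷ 12 ∷ 1 ∷ 14 ∷ 15 ∷ 8 ∷ 5 ∷ 10 ∷ 11 ∷ [] , 9 ∷ 6 ∷ 4 ∷ 5 ∷ 10 ∷ 5 ∷ 3 ∷ 4 ∷ 8 ∷ 7 ∷ 1 ∷ 0 ∷ 9 ∷ 6 ∷ 2 ∷ 1 ∷ [])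
  ∷ (4 ∷ 9 ∷ 3 ∷ 2 ∷ 0 ∷ 13 ∷ 14 ∷ 15 ∷ 12 ∷ 1 ∷ 11 ∷ 10 ∷ 8 ∷ 5 ∷ 6 ∷ 7 ∷ [] , 9 ∷ 6 ∷ 4 ∷ 5 ∷ 10 ∷ 1 ∷ 1 ∷ 0 ∷ 8 ∷ 7 ∷ 3 ∷ 4 ∷ 9 ∷ 2 ∷ 2 ∷ 1 ∷ [])
  ∷ (4 ∷ 9 ∷ 6 ∷ 7 ∷ 0 ∷ 13 ∷ 2 ∷ 3 ∷ 10 ∷ 1 ∷ 8 ∷ 15 ∷ 14 ∷ 5 ∷ 12 ∷ 11 ∷ [] , 9 ∷ 4 ∷ 8 ∷ 1 ∷ 10 ∷ 3 ∷ 9 ∷ 2 ∷ 6 ∷ 5 ∷ 7 ∷ 0 ∷ 5 ∷ 4 ∷ 6 ∷ 1 ∷ [])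
  ∷ (4 ∷ 9 ∷ 6 ∷ 7 ∷ 0 ∷ 13 ∷ 2 ∷ 3 ∷ 12 ∷ 1 ∷ 11 ∷ 10 ∷ 8 ∷ 5 ∷ 15 ∷ 14 ∷ [] , 9 ∷ 6 ∷ 4 ∷ 3 ∷ 10 ∷ 5 ∷ 5 ∷ 4 ∷ 8 ∷ 7 ∷ 1 ∷ 2 ∷ 9 ∷ 6 ∷ 0 ∷ 1 ∷ [])
  ∷ (4 ∷ 9 ∷ 6 ∷ 7 ∷ 0 ∷ 13 ∷ 2 ∷ 3 ∷ 12 ∷ 1 ∷ 14 ∷ 15 ∷ 8 ∷ 5 ∷ 10 ∷ 11 ∷ [] , 7 ∷ 4 ∷ 2 ∷ 1 ∷ 8 ∷ 3 ∷ 3 ∷ 2 ∷ 6 ∷ 5 ∷ 1 ∷ 0 ∷ 7 ∷ 4 ∷ 2 ∷ 1 ∷ [])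
  ∷ (4 ∷ 9 ∷ 6 ∷ 11 ∷ 0 ∷ 7 ∷ 2 ∷ 5 ∷ 10 ∷ 1 ∷ 8 ∷ 3 ∷ 13 ∷ 12 ∷ 15 ∷ 14 ∷ [] , 11 ∷ 6 ∷ 10 ∷ 5 ∷ 12 ∷ 3 ∷ 11 ∷ 4 ∷ 8 ∷ 7 ∷ 9 ∷ 6 ∷ 1 ∷ 2 ∷ 0 ∷ 1 ∷ [])
  ∷ (4 ∷ 9 ∷ 6 ∷ 11 ∷ 0 ∷ 7 ∷ 2 ∷ 5 ∷ 10 ∷ 1 ∷ 8 ∷ 3 ∷ 14 ∷ 15 ∷ 12 ∷ 13 ∷ [] , 9 ∷ 4 ∷ 8 ∷ 3 ∷ 10 ∷ 1 ∷ 9 ∷ 2 ∷ 6 ∷ 5 ∷ 7 ∷ 4 ∷ 1 ∷ 0 ∷ 2 ∷ 1 ∷ [])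
  ∷ (4 ∷ 9 ∷ 6 ∷ 11 ∷ 0 ∷ 7 ∷ 2 ∷ 5 ∷ 12 ∷ 1 ∷ 14 ∷ 3 ∷ 8 ∷ 15 ∷ 10 ∷ 13 ∷ [] , 7 ∷ 4 ∷ 6 ∷ 3 ∷ 8 ∷ 1 ∷ 7 ∷ 2 ∷ 6 ∷ 5 ∷ 5 ∷ 4 ∷ 7 ∷ 0 ∷ 6 ∷ 1 ∷ [])
  ∷ (4 ∷ 9 ∷ 6 ∷ 11 ∷ 0 ∷ 13 ∷ 2 ∷ 15 ∷ 10 ∷ 1 ∷ 8 ∷ 3 ∷ 14 ∷ 5 ∷ 12 ∷ 7 ∷ [] , 7 ∷ 2 ∷ 6 ∷ 1 ∷ 8 ∷ 1 ∷ 7 ∷ 0 ∷ 4 ∷ 3 ∷ 5 ∷ 2 ∷ 3 ∷ 2 ∷ 4 ∷ 1 ∷ [])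
  ∷ (4 ∷ 9 ∷ 6 ∷ 11 ∷ 0 ∷ 13 ∷ 2 ∷ 15 ∷ 12 ∷ 1 ∷ 14 ∷ 3 ∷ 8 ∷ 5 ∷ 10 ∷ 7 ∷ [] , 5 ∷ 2 ∷ 4 ∷ 1 ∷ 6 ∷ 1 ∷ 5 ∷ 0 ∷ 4 ∷ 3 ∷ 3 ∷ 2 ∷ 5 ∷ 2 ∷ 4 ∷ 1 ∷ [])
  ∷ (4 ∷ 9 ∷ 10 ∷ 7 ∷ 0 ∷ 13 ∷ 14 ∷ 3 ∷ 12 ∷ 1 ∷ 2 ∷ 15 ∷ 8 ∷ 5 ∷ 6 ∷ 11 ∷ [] , 7 ∷ 4 ∷ 4 ∷ 1 ∷ 8 ∷ 3 ∷ 3 ∷ 2 ∷ 6 ∷ 5 ∷ 5 ∷ 0 ∷ 7 ∷ 4 ∷ 4 ∷ 1 ∷ [])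
  ∷ (4 ∷ 9 ∷ 10 ∷ 11 ∷ 0 ∷ 7 ∷ 14 ∷ 5 ∷ 12 ∷ 1 ∷ 2 ∷ 3 ∷ 8 ∷ 15 ∷ 6 ∷ 13 ∷ [] , 7 ∷ 4 ∷ 4 ∷ 3 ∷ 8 ∷ 1 ∷ 3 ∷ 2 ∷ 6 ∷ 5 ∷ 5 ∷ 4 ∷ 7 ∷ 0 ∷ 4 ∷ 1 ∷ [])
  ∷ (4 ∷ 9 ∷ 10 ∷ 11 ∷ 0 ∷ 13 ∷ 7 ∷ 6 ∷ 12 ∷ 1 ∷ 2 ∷ 3 ∷ 8 ∷ 5 ∷ 15 ∷ 14 ∷ [] , 7 ∷ 4 ∷ 4 ∷ 3 ∷ 8 ∷ 3 ∷ 1 ∷ 2 ∷ 6 ∷ 5 ∷ 5 ∷ 4 ∷ 7 ∷ 4 ∷ 0 ∷ 1 ∷ [])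
  ∷ (4 ∷ 9 ∷ 10 ∷ 11 ∷ 0 ∷ 13 ∷ 14 ∷ 15 ∷ 12 ∷ 1 ∷ 2 ∷ 3 ∷ 8 ∷ 5 ∷ 6 ∷ 7 ∷ [] , 5 ∷ 2 ∷ 2 ∷ 1 ∷ 6 ∷ 1 ∷ 1 ∷ 0 ∷ 4 ∷ 3 ∷ 3 ∷ 2 ∷ 5 ∷ 2 ∷ 2 ∷ 1 ∷ [])
  ∷ (8 ∷ 3 ∷ 6 ∷ 1 ∷ 12 ∷ 7 ∷ 2 ∷ 5 ∷ 0 ∷ 11 ∷ 14 ∷ 9 ∷ 4 ∷ 15 ∷ 10 ∷ 13 ∷ [] , 7 ∷ 2 ∷ 4 ∷ 3 ∷ 6 ∷ 1 ∷ 5 ∷ 2 ∷ 8 ∷ 1 ∷ 3 ∷ 2 ∷ 7 ∷ 0 ∷ 4 ∷ 1 ∷ [])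
  ∷ (8 ∷ 3 ∷ 6 ∷ 1 ∷ 12 ∷ 7 ∷ 2 ∷ 5 ∷ 0 ∷ 13 ∷ 11 ∷ 10 ∷ 4 ∷ 9 ∷ 15 ∷ 14 ∷ [] , 11 ∷ 6 ∷ 8 ∷ 7 ∷ 10 ∷ 5 ∷ 9 ∷ 6 ∷ 12 ∷ 3 ∷ 1 ∷ 2 ∷ 11 ∷ 4 ∷ 0 ∷ 1 ∷ [])
  ∷ (8 ∷ 3 ∷ 6 ∷ 1 ∷ 12 ∷ 7 ∷ 2 ∷ 5 ∷ 0 ∷ 13 ∷ 14 ∷ 15 ∷ 4 ∷ 9 ∷ 10 ∷ 11 ∷ [] , 9 ∷ 4 ∷ 6 ∷ 5 ∷ 8 ∷ 3 ∷ 7 ∷ 4 ∷ 10 ∷ 1 ∷ 1 ∷ 0 ∷ 9 ∷ 2 ∷ 2 ∷ 1 ∷ [])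
  ∷ (8 ∷ 3 ∷ 6 ∷ 1 ∷ 12 ∷ 13 ∷ 2 ∷ 15 ∷ 0 ∷ 11 ∷ 14 ∷ 9 ∷ 4 ∷ 5 ∷ 10 ∷ 7 ∷ [] , 9 ∷ 4 ∷ 6 ∷ 5 ∷ 8 ∷ 1 ∷ 7 ∷ 0 ∷ 10 ∷ 3 ∷ 5 ∷ 4 ∷ 9 ∷ 2 ∷ 6 ∷ 1 ∷ [])
  ∷ (8 ∷ 3 ∷ 10 ∷ 1 ∷ 5 ∷ 4 ∷ 7 ∷ 6 ∷ 0 ∷ 11 ∷ 2 ∷ 9 ∷ 13 ∷ 12 ∷ 15 ∷ 14 ∷ [] , 7 ∷ 4 ∷ 6 ∷ 5 ∷ 2 ∷ 3 ∷ 1 ∷ 2 ∷ 8 ∷ 3 ∷ 7 ∷ 4 ∷ 1 ∷ 2 ∷ 0 ∷ 1 ∷ [])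
  ∷ (8 ∷ 3 ∷ 10 ∷ 1 ∷ 5 ∷ 4 ∷ 7 ∷ 6 ∷ 0 ∷ 11 ∷ 2 ∷ 9 ∷ 14 ∷ 15 ∷ 12 ∷ 13 ∷ [] , 9 ∷ 6 ∷ 8 ∷ 7 ∷ 4 ∷ 5 ∷ 3 ∷ 4 ∷ 10 ∷ 1 ∷ 9 ∷ 2 ∷ 1 ∷ 0 ∷ 2 ∷ 1 ∷ [])
  ∷ (8 ∷ 3 ∷ 10 ∷ 1 ∷ 5 ∷ 4 ∷ 7 ∷ 6 ∷ 0 ∷ 13 ∷ 2 ∷ 15 ∷ 14 ∷ 9 ∷ 12 ∷ 11 ∷ [] , 11 ∷ 8 ∷ 10 ∷ 9 ∷ 6 ∷ 7 ∷ 5 ∷ 6 ∷ 12 ∷ 1 ∷ 11 ∷ 0 ∷ 3 ∷ 2 ∷ 4 ∷ 1 ∷ [])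
  ∷ (8 ∷ 3 ∷ 10 ∷ 1 ∷ 5 ∷ 4 ∷ 14 ∷ 15 ∷ 0 ∷ 11 ∷ 2 ∷ 9 ∷ 13 ∷ 12 ∷ 6 ∷ 7 ∷ [] , 9 ∷ 6 ∷ 8 ∷ 7 ∷ 4 ∷ 5 ∷ 1 ∷ 0 ∷ 10 ∷ 5 ∷ 9 ∷ 6 ∷ 3 ∷ 4 ∷ 2 ∷ 1 ∷ [])
  ∷ (8 ∷ 3 ∷ 10 ∷ 1 ∷ 6 ∷ 7 ∷ 4 ∷ 5 ∷ 0 ∷ 11 ∷ 2 ∷ 9 ∷ 13 ∷ 12 ∷ 15 ∷ 14 ∷ [] , 7 ∷ 4 ∷ 6 ∷ 5 ∷ 4 ∷ 3 ∷ 5 ∷ 4 ∷ 8 ∷ 3 ∷ 7 ∷ 4 ∷ 1 ∷ 2 ∷ 0 ∷ 1 ∷ [])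
  ∷ (8 ∷ 3 ∷ 10 ∷ 1 ∷ 6 ∷ 7 ∷ 4 ∷ 5 ∷ 0 ∷ 11 ∷ 2 ∷ 9 ∷ 14 ∷ 15 ∷ 12 ∷ 13 ∷ [] , 5 ∷ 2 ∷ 4 ∷ 3 ∷ 2 ∷ 1 ∷ 3 ∷ 2 ∷ 6 ∷ 1 ∷ 5 ∷ 2 ∷ 1 ∷ 0 ∷ 2 ∷ 1 ∷ [])
  ∷ (8 ∷ 3 ∷ 10 ∷ 1 ∷ 6 ∷ 7 ∷ 4 ∷ 5 ∷ 0 ∷ 13 ∷ 2 ∷ 15 ∷ 14 ∷ 9 ∷ 12 ∷ 11 ∷ [] , 7 ∷ 4 ∷ 6 ∷ 5 ∷ 4 ∷ 3 ∷ 5 ∷ 4 ∷ 8 ∷ 1 ∷ 7 ∷ 0 ∷ 3 ∷ 2 ∷ 4 ∷ 1 ∷ [])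
  ∷ (8 ∷ 3 ∷ 10 ∷ 1 ∷ 6 ∷ 13 ∷ 4 ∷ 15 ∷ 0 ∷ 11 ∷ 2 ∷ 9 ∷ 14 ∷ 5 ∷ 12 ∷ 7 ∷ [] , 7 ∷ 4 ∷ 6 ∷ 5 ∷ 4 ∷ 1 ∷ 5 ∷ 0 ∷ 8 ∷ 3 ∷ 7 ∷ 4 ∷ 3 ∷ 2 ∷ 4 ∷ 1 ∷ [])
  ∷ (8 ∷ 3 ∷ 10 ∷ 1 ∷ 12 ∷ 7 ∷ 14 ∷ 5 ∷ 0 ∷ 11 ∷ 2 ∷ 9 ∷ 4 ∷ 15 ∷ 6 ∷ 13 ∷ [] , 5 ∷ 2 ∷ 4 ∷ 3 ∷ 4 ∷ 1 ∷ 3 ∷ 2 ∷ 6 ∷ 1 ∷ 5 ∷ 2 ∷ 5 ∷ 0 ∷ 4 ∷ 1 ∷ [])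
  ∷ (8 ∷ 3 ∷ 10 ∷ 1 ∷ 12 ∷ 7 ∷ 14 ∷ 5 ∷ 0 ∷ 13 ∷ 2 ∷ 15 ∷ 4 ∷ 9 ∷ 6 ∷ 11 ∷ [] , 7 ∷ 4 ∷ 6 ∷ 5 ∷ 6 ∷ 3 ∷ 5 ∷ 4 ∷ 8 ∷ 1 ∷ 7 ∷ 0 ∷ 7 ∷ 2 ∷ 6 ∷ 1 ∷ [])
  ∷ (8 ∷ 3 ∷ 10 ∷ 1 ∷ 12 ∷ 13 ∷ 7 ∷ 6 ∷ 0 ∷ 11 ∷ 2 ∷ 9 ∷ 4 ∷ 5 ∷ 15 ∷ 14 ∷ [] , 9 ∷ 6 ∷ 8 ∷ 7 ∷ 4 ∷ 3 ∷ 1 ∷ 2 ∷ 10 ∷ 5 ∷ 9 ∷ 6 ∷ 5 ∷ 4 ∷ 0 ∷ 1 ∷ [])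
  ∷ (8 ∷ 3 ∷ 10 ∷ 1 ∷ 12 ∷ 13 ∷ 14 ∷ 15 ∷ 0 ∷ 11 ∷ 2 ∷ 9 ∷ 4 ∷ 5 ∷ 6 ∷ 7 ∷ [] , 7 ∷ 4 ∷ 6 ∷ 5 ∷ 2 ∷ 1 ∷ 1 ∷ 0 ∷ 8 ∷ 3 ∷ 7 ∷ 4 ∷ 3 ∷ 2 ∷ 2 ∷ 1 ∷ [])
  ∷ (8 ∷ 5 ∷ 3 ∷ 2 ∷ 12 ∷ 1 ∷ 7 ∷ 6 ∷ 0 ∷ 11 ∷ 14 ∷ 9 ∷ 4 ∷ 15 ∷ 10 ∷ 13 ∷ [] , 11 ∷ 8 ∷ 6 ∷ 7 ∷ 10 ∷ 9 ∷ 5 ∷ 6 ∷ 12 ∷ 1 ∷ 3 ∷ 2 ∷ 11 ∷ 0 ∷ 4 ∷ 1 ∷ [])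
  ∷ (8 ∷ 5 ∷ 3 ∷ 2 ∷ 12 ∷ 1 ∷ 7 ∷ 6 ∷ 0 ∷ 13 ∷ 11 ∷ 10 ∷ 4 ∷ 9 ∷ 15 ∷ 14 ∷ [] , 7 ∷ 4 ∷ 2 ∷ 3 ∷ 6 ∷ 5 ∷ 1 ∷ 2 ∷ 8 ∷ 3 ∷ 1 ∷ 2 ∷ 7 ∷ 4 ∷ 0 ∷ 1 ∷ [])
  ∷ (8 ∷ 5 ∷ 3 ∷ 2 ∷ 12 ∷ 1 ∷ 7 ∷ 6 ∷ 0 ∷ 13 ∷ 14 ∷ 15 ∷ 4 ∷ 9 ∷ 10 ∷ 11 ∷ [] , 9 ∷ 6 ∷ 4 ∷ 5 ∷ 8 ∷ 7 ∷ 3 ∷ 4 ∷ 10 ∷ 1 ∷ 1 ∷ 0 ∷ 9 ∷ 2 ∷ 2 ∷ 1 ∷ [])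
  ∷ (8 ∷ 5 ∷ 3 ∷ 2 ∷ 12 ∷ 1 ∷ 14 ∷ 15 ∷ 0 ∷ 13 ∷ 11 ∷ 10 ∷ 4 ∷ 9 ∷ 6 ∷ 7 ∷ [] , 9 ∷ 6 ∷ 4 ∷ 5 ∷ 8 ∷ 7 ∷ 1 ∷ 0 ∷ 10 ∷ 5 ∷ 3 ∷ 4 ∷ 9 ∷ 6 ∷ 2 ∷ 1 ∷ [])
  ∷ (8 ∷ 5 ∷ 6 ∷ 7 ∷ 12 ∷ 1 ∷ 2 ∷ 3 ∷ 0 ∷ 11 ∷ 14 ∷ 9 ∷ 4 ∷ 15 ∷ 10 ∷ 13 ∷ [] , 7 ∷ 4 ∷ 4 ∷ 3 ∷ 6 ∷ 5 ∷ 5 ∷ 4 ∷ 8 ∷ 1 ∷ 3 ∷ 2 ∷ 7 ∷ 0 ∷ 4 ∷ 1 ∷ [])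
  ∷ (8 ∷ 5 ∷ 6 ∷ 7 ∷ 12 ∷ 1 ∷ 2 ∷ 3 ∷ 0 ∷ 13 ∷ 11 ∷ 10 ∷ 4 ∷ 9 ∷ 15 ∷ 14 ∷ [] , 7 ∷ 4 ∷ 4 ∷ 3 ∷ 6 ∷ 5 ∷ 5 ∷ 4 ∷ 8 ∷ 3 ∷ 1 ∷ 2 ∷ 7 ∷ 4 ∷ 0 ∷ 1 ∷ [])
  ∷ (8 ∷ 5 ∷ 6 ∷ 7 ∷ 12 ∷ 1 ∷ 2 ∷ 3 ∷ 0 ∷ 13 ∷ 14 ∷ 15 ∷ 4 ∷ 9 ∷ 10 ∷ 11 ∷ [] , 5 ∷ 2 ∷ 2 ∷ 1 ∷ 4 ∷ 3 ∷ 3 ∷ 2 ∷ 6 ∷ 1 ∷ 1 ∷ 0 ∷ 5 ∷ 2 ∷ 2 ∷ 1 ∷ [])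
  ∷ (8 ∷ 5 ∷ 6 ∷ 11 ∷ 12 ∷ 1 ∷ 2 ∷ 15 ∷ 0 ∷ 13 ∷ 14 ∷ 3 ∷ 4 ∷ 9 ∷ 10 ∷ 7 ∷ [] , 7 ∷ 4 ∷ 4 ∷ 1 ∷ 6 ∷ 5 ∷ 5 ∷ 0 ∷ 8 ∷ 3 ∷ 3 ∷ 2 ∷ 7 ∷ 4 ∷ 4 ∷ 1 ∷ [])
  ∷ (8 ∷ 5 ∷ 10 ∷ 7 ∷ 6 ∷ 1 ∷ 4 ∷ 3 ∷ 0 ∷ 11 ∷ 2 ∷ 9 ∷ 13 ∷ 12 ∷ 15 ∷ 14 ∷ [] , 11 ∷ 6 ∷ 10 ∷ 5 ∷ 8 ∷ 7 ∷ 9 ∷ 6 ∷ 12 ∷ 3 ∷ 11 ∷ 4 ∷ 1 ∷ 2 ∷ 0 ∷ 1 ∷ [])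
  ∷ (8 ∷ 5 ∷ 10 ∷ 7 ∷ 6 ∷ 1 ∷ 4 ∷ 3 ∷ 0 ∷ 11 ∷ 2 ∷ 9 ∷ 14 ∷ 15 ∷ 12 ∷ 13 ∷ [] , 9 ∷ 4 ∷ 8 ∷ 3 ∷ 6 ∷ 5 ∷ 7 ∷ 4 ∷ 10 ∷ 1 ∷ 9 ∷ 2 ∷ 1 ∷ 0 ∷ 2 ∷ 1 ∷ [])
  ∷ (8 ∷ 5 ∷ 10 ∷ 7 ∷ 6 ∷ 1 ∷ 4 ∷ 3 ∷ 0 ∷ 13 ∷ 2 ∷ 15 ∷ 14 ∷ 9 ∷ 12 ∷ 11 ∷ [] , 7 ∷ 2 ∷ 6 ∷ 1 ∷ 4 ∷ 3 ∷ 5 ∷ 2 ∷ 8 ∷ 1 ∷ 7 ∷ 0 ∷ 3 ∷ 2 ∷ 4 ∷ 1 ∷ [])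
  ∷ (8 ∷ 5 ∷ 10 ∷ 7 ∷ 12 ∷ 1 ∷ 14 ∷ 3 ∷ 0 ∷ 11 ∷ 2 ∷ 9 ∷ 4 ∷ 15 ∷ 6 ∷ 13 ∷ [] , 7 ∷ 4 ∷ 6 ∷ 3 ∷ 6 ∷ 5 ∷ 5 ∷ 4 ∷ 8 ∷ 1 ∷ 7 ∷ 2 ∷ 7 ∷ 0 ∷ 6 ∷ 1 ∷ [])
  ∷ (8 ∷ 5 ∷ 10 ∷ 7 ∷ 12 ∷ 1 ∷ 14 ∷ 3 ∷ 0 ∷ 13 ∷ 2 ∷ 15 ∷ 4 ∷ 9 ∷ 6 ∷ 11 ∷ [] , 5 ∷ 2 ∷ 4 ∷ 1 ∷ 4 ∷ 3 ∷ 3 ∷ 2 ∷ 6 ∷ 1 ∷ 5 ∷ 0 ∷ 5 ∷ 2 ∷ 4 ∷ 1 ∷ [])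
  ∷ (8 ∷ 5 ∷ 10 ∷ 11 ∷ 6 ∷ 1 ∷ 4 ∷ 15 ∷ 0 ∷ 13 ∷ 2 ∷ 3 ∷ 14 ∷ 9 ∷ 12 ∷ 7 ∷ [] , 9 ∷ 4 ∷ 8 ∷ 1 ∷ 6 ∷ 5 ∷ 7 ∷ 0 ∷ 10 ∷ 3 ∷ 9 ∷ 2 ∷ 5 ∷ 4 ∷ 6 ∷ 1 ∷ [])
  ∷ (8 ∷ 5 ∷ 10 ∷ 11 ∷ 12 ∷ 1 ∷ 7 ∷ 6 ∷ 0 ∷ 13 ∷ 2 ∷ 3 ∷ 4 ∷ 9 ∷ 15 ∷ 14 ∷ [] , 9 ∷ 6 ∷ 4 ∷ 3 ∷ 8 ∷ 7 ∷ 1 ∷ 2 ∷ 10 ∷ 5 ∷ 5 ∷ 4 ∷ 9 ∷ 6 ∷ 0 ∷ 1 ∷ [])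
  ∷ (8 ∷ 5 ∷ 10 ∷ 11 ∷ 12 ∷ 1 ∷ 14 ∷ 15 ∷ 0 ∷ 13 ∷ 2 ∷ 3 ∷ 4 ∷ 9 ∷ 6 ∷ 7 ∷ [] , 7 ∷ 4 ∷ 2 ∷ 1 ∷ 6 ∷ 5 ∷ 1 ∷ 0 ∷ 8 ∷ 3 ∷ 3 ∷ 2 ∷ 7 ∷ 4 ∷ 2 ∷ 1 ∷ [])
  ∷ (8 ∷ 9 ∷ 3 ∷ 2 ∷ 5 ∷ 4 ∷ 7 ∷ 6 ∷ 0 ∷ 1 ∷ 11 ∷ 10 ∷ 13 ∷ 12 ∷ 15 ∷ 14 ∷ [] , 5 ∷ 4 ∷ 2 ∷ 3 ∷ 2 ∷ 3 ∷ 1 ∷ 2 ∷ 6 ∷ 5 ∷ 1 ∷ 2 ∷ 1 ∷ 2 ∷ 0 ∷ 1 ∷ [])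
  ∷ (8 ∷ 9 ∷ 3 ∷ 2 ∷ 5 ∷ 4 ∷ 7 ∷ 6 ∷ 0 ∷ 1 ∷ 11 ∷ 10 ∷ 14 ∷ 15 ∷ 12 ∷ 13 ∷ [] , 7 ∷ 6 ∷ 4 ∷ 5 ∷ 4 ∷ 5 ∷ 3 ∷ 4 ∷ 8 ∷ 7 ∷ 3 ∷ 4 ∷ 1 ∷ 0 ∷ 2 ∷ 1 ∷ [])
  ∷ (8 ∷ 9 ∷ 3 ∷ 2 ∷ 5 ∷ 4 ∷ 7 ∷ 6 ∷ 0 ∷ 1 ∷ 14 ∷ 15 ∷ 13 ∷ 12 ∷ 10 ∷ 11 ∷ [] , 7 ∷ 6 ∷ 4 ∷ 5 ∷ 4 ∷ 5 ∷ 3 ∷ 4 ∷ 8 ∷ 7 ∷ 1 ∷ 0 ∷ 3 ∷ 4 ∷ 2 ∷ 1 ∷ [])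
  ∷ (8 ∷ 9 ∷ 3 ∷ 2 ∷ 5 ∷ 4 ∷ 14 ∷ 15 ∷ 0 ∷ 1 ∷ 11 ∷ 10 ∷ 13 ∷ 12 ∷ 6 ∷ 7 ∷ [] , 7 ∷ 6 ∷ 4 ∷ 5 ∷ 4 ∷ 5 ∷ 1 ∷ 0 ∷ 8 ∷ 7 ∷ 3 ∷ 4 ∷ 3 ∷ 4 ∷ 2 ∷ 1 ∷ [])
  ∷ (8 ∷ 9 ∷ 3 ∷ 2 ∷ 6 ∷ 7 ∷ 4 ∷ 5 ∷ 0 ∷ 1 ∷ 11 ∷ 10 ∷ 13 ∷ 12 ∷ 15 ∷ 14 ∷ [] , 9 ∷ 8 ∷ 6 ∷ 7 ∷ 4 ∷ 3 ∷ 5 ∷ 4 ∷ 10 ∷ 9 ∷ 1 ∷ 2 ∷ 1 ∷ 2 ∷ 0 ∷ 1 ∷ [])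
  ∷ (8 ∷ 9 ∷ 3 ∷ 2 ∷ 6 ∷ 7 ∷ 4 ∷ 5 ∷ 0 ∷ 1 ∷ 11 ∷ 10 ∷ 14 ∷ 15 ∷ 12 ∷ 13 ∷ [] , 7 ∷ 6 ∷ 4 ∷ 5 ∷ 2 ∷ 1 ∷ 3 ∷ 2 ∷ 8 ∷ 7 ∷ 3 ∷ 4 ∷ 1 ∷ 0 ∷ 2 ∷ 1 ∷ [])
  ∷ (8 ∷ 9 ∷ 3 ∷ 2 ∷ 6 ∷ 7 ∷ 4 ∷ 5 ∷ 0 ∷ 1 ∷ 14 ∷ 15 ∷ 13 ∷ 12 ∷ 10 ∷ 11 ∷ [] , 11 ∷ 10 ∷ 8 ∷ 9 ∷ 6 ∷ 5 ∷ 7 ∷ 6 ∷ 12 ∷ 11 ∷ 1 ∷ 0 ∷ 3 ∷ 4 ∷ 2 ∷ 1 ∷ [])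
  ∷ (8 ∷ 9 ∷ 3 ∷ 2 ∷ 6 ∷ 13 ∷ 4 ∷ 15 ∷ 0 ∷ 1 ∷ 11 ∷ 10 ∷ 14 ∷ 5 ∷ 12 ∷ 7 ∷ [] , 9 ∷ 8 ∷ 6 ∷ 7 ∷ 4 ∷ 1 ∷ 5 ∷ 0 ∷ 10 ∷ 9 ∷ 5 ∷ 6 ∷ 3 ∷ 2 ∷ 4 ∷ 1 ∷ [])
  ∷ (8 ∷ 9 ∷ 3 ∷ 2 ∷ 12 ∷ 7 ∷ 14 ∷ 5 ∷ 0 ∷ 1 ∷ 11 ∷ 10 ∷ 4 ∷ 15 ∷ 6 ∷ 13 ∷ [] , 9 ∷ 8 ∷ 6 ∷ 7 ∷ 4 ∷ 1 ∷ 3 ∷ 2 ∷ 10 ∷ 9 ∷ 5 ∷ 6 ∷ 5 ∷ 0 ∷ 4 ∷ 1 ∷ [])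
  ∷ (8 ∷ 9 ∷ 3 ∷ 2 ∷ 12 ∷ 13 ∷ 7 ∷ 6 ∷ 0 ∷ 1 ∷ 11 ∷ 10 ∷ 4 ∷ 5 ∷ 15 ∷ 14 ∷ [] , 5 ∷ 4 ∷ 2 ∷ 3 ∷ 4 ∷ 3 ∷ 1 ∷ 2 ∷ 6 ∷ 5 ∷ 1 ∷ 2 ∷ 5 ∷ 4 ∷ 0 ∷ 1 ∷ [])
  ∷ (8 ∷ 9 ∷ 3 ∷ 2 ∷ 12 ∷ 13 ∷ 7 ∷ 6 ∷ 0 ∷ 1 ∷ 14 ∷ 15 ∷ 4 ∷ 5 ∷ 10 ∷ 11 ∷ [] , 7 ∷ 6 ∷ 4 ∷ 5 ∷ 6 ∷ 5 ∷ 3 ∷ 4 ∷ 8 ∷ 7 ∷ 1 ∷ 0 ∷ 7 ∷ 6 ∷ 2 ∷ 1 ∷ [])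
  ∷ (8 ∷ 9 ∷ 3 ∷ 2 ∷ 12 ∷ 13 ∷ 14 ∷ 15 ∷ 0 ∷ 1 ∷ 11 ∷ 10 ∷ 4 ∷ 5 ∷ 6 ∷ 7 ∷ [] , 7 ∷ 6 ∷ 4 ∷ 5 ∷ 2 ∷ 1 ∷ 1 ∷ 0 ∷ 8 ∷ 7 ∷ 3 ∷ 4 ∷ 3 ∷ 2 ∷ 2 ∷ 1 ∷ [])
  ∷ (8 ∷ 9 ∷ 6 ∷ 7 ∷ 5 ∷ 4 ∷ 2 ∷ 3 ∷ 0 ∷ 1 ∷ 11 ∷ 10 ∷ 13 ∷ 12 ∷ 15 ∷ 14 ∷ [] , 9 ∷ 8 ∷ 4 ∷ 3 ∷ 6 ∷ 7 ∷ 5 ∷ 4 ∷ 10 ∷ 9 ∷ 1 ∷ 2 ∷ 1 ∷ 2 ∷ 0 ∷ 1 ∷ [])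
  ∷ (8 ∷ 9 ∷ 6 ∷ 7 ∷ 5 ∷ 4 ∷ 2 ∷ 3 ∷ 0 ∷ 1 ∷ 11 ∷ 10 ∷ 14 ∷ 15 ∷ 12 ∷ 13 ∷ [] , 11 ∷ 10 ∷ 6 ∷ 5 ∷ 8 ∷ 9 ∷ 7 ∷ 6 ∷ 12 ∷ 11 ∷ 3 ∷ 4 ∷ 1 ∷ 0 ∷ 2 ∷ 1 ∷ [])
  ∷ (8 ∷ 9 ∷ 6 ∷ 7 ∷ 5 ∷ 4 ∷ 2 ∷ 3 ∷ 0 ∷ 1 ∷ 14 ∷ 15 ∷ 13 ∷ 12 ∷ 10 ∷ 11 ∷ [] , 7 ∷ 6 ∷ 2 ∷ 1 ∷ 4 ∷ 5 ∷ 3 ∷ 2 ∷ 8 ∷ 7 ∷ 1 ∷ 0 ∷ 3 ∷ 4 ∷ 2 ∷ 1 ∷ [])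
  ∷ (8 ∷ 9 ∷ 6 ∷ 7 ∷ 12 ∷ 13 ∷ 2 ∷ 3 ∷ 0 ∷ 1 ∷ 11 ∷ 10 ∷ 4 ∷ 5 ∷ 15 ∷ 14 ∷ [] , 7 ∷ 6 ∷ 4 ∷ 3 ∷ 6 ∷ 5 ∷ 5 ∷ 4 ∷ 8 ∷ 7 ∷ 1 ∷ 2 ∷ 7 ∷ 6 ∷ 0 ∷ 1 ∷ [])
  ∷ (8 ∷ 9 ∷ 6 ∷ 7 ∷ 12 ∷ 13 ∷ 2 ∷ 3 ∷ 0 ∷ 1 ∷ 14 ∷ 15 ∷ 4 ∷ 5 ∷ 10 ∷ 11 ∷ [] , 5 ∷ 4 ∷ 2 ∷ 1 ∷ 4 ∷ 3 ∷ 3 ∷ 2 ∷ 6 ∷ 5 ∷ 1 ∷ 0 ∷ 5 ∷ 4 ∷ 2 ∷ 1 ∷ [])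
  ∷ (8 ∷ 9 ∷ 6 ∷ 11 ∷ 5 ∷ 4 ∷ 2 ∷ 15 ∷ 0 ∷ 1 ∷ 14 ∷ 3 ∷ 13 ∷ 12 ∷ 10 ∷ 7 ∷ [] , 9 ∷ 8 ∷ 4 ∷ 1 ∷ 6 ∷ 7 ∷ 5 ∷ 0 ∷ 10 ∷ 9 ∷ 3 ∷ 2 ∷ 5 ∷ 6 ∷ 4 ∷ 1 ∷ [])
  ∷ (8 ∷ 9 ∷ 6 ∷ 11 ∷ 12 ∷ 7 ∷ 2 ∷ 5 ∷ 0 ∷ 1 ∷ 14 ∷ 3 ∷ 4 ∷ 15 ∷ 10 ∷ 13 ∷ [] , 9 ∷ 4 ∷ 6 ∷ 3 ∷ 8 ∷ 1 ∷ 7 ∷ 2 ∷ 10 ∷ 5 ∷ 5 ∷ 4 ∷ 9 ∷ 0 ∷ 6 ∷ 1 ∷ [])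
  ∷ (8 ∷ 9 ∷ 6 ∷ 11 ∷ 12 ∷ 13 ∷ 2 ∷ 15 ∷ 0 ∷ 1 ∷ 14 ∷ 3 ∷ 4 ∷ 5 ∷ 10 ∷ 7 ∷ [] , 7 ∷ 2 ∷ 4 ∷ 1 ∷ 6 ∷ 1 ∷ 5 ∷ 0 ∷ 8 ∷ 3 ∷ 3 ∷ 2 ∷ 7 ∷ 2 ∷ 4 ∷ 1 ∷ [])
  ∷ (8 ∷ 9 ∷ 10 ∷ 7 ∷ 5 ∷ 4 ∷ 14 ∷ 3 ∷ 0 ∷ 1 ∷ 2 ∷ 15 ∷ 13 ∷ 12 ∷ 6 ∷ 11 ∷ [] , 9 ∷ 8 ∷ 4 ∷ 1 ∷ 6 ∷ 7 ∷ 3 ∷ 2 ∷ 10 ∷ 9 ∷ 5 ∷ 0 ∷ 5 ∷ 6 ∷ 4 ∷ 1 ∷ [])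
  ∷ (8 ∷ 9 ∷ 10 ∷ 7 ∷ 6 ∷ 13 ∷ 4 ∷ 3 ∷ 0 ∷ 1 ∷ 2 ∷ 15 ∷ 14 ∷ 5 ∷ 12 ∷ 11 ∷ [] , 9 ∷ 4 ∷ 8 ∷ 1 ∷ 6 ∷ 3 ∷ 7 ∷ 2 ∷ 10 ∷ 5 ∷ 9 ∷ 0 ∷ 5 ∷ 4 ∷ 6 ∷ 1 ∷ [])
  ∷ (8 ∷ 9 ∷ 10 ∷ 7 ∷ 12 ∷ 13 ∷ 14 ∷ 3 ∷ 0 ∷ 1 ∷ 2 ∷ 15 ∷ 4 ∷ 5 ∷ 6 ∷ 11 ∷ [] , 5 ∷ 4 ∷ 4 ∷ 1 ∷ 4 ∷ 3 ∷ 3 ∷ 2 ∷ 6 ∷ 5 ∷ 5 ∷ 0 ∷ 5 ∷ 4 ∷ 4 ∷ 1 ∷ [])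
  ∷ (8 ∷ 9 ∷ 10 ∷ 11 ∷ 5 ∷ 4 ∷ 7 ∷ 6 ∷ 0 ∷ 1 ∷ 2 ∷ 3 ∷ 13 ∷ 12 ∷ 15 ∷ 14 ∷ [] , 5 ∷ 4 ∷ 4 ∷ 3 ∷ 2 ∷ 3 ∷ 1 ∷ 2 ∷ 6 ∷ 5 ∷ 5 ∷ 4 ∷ 1 ∷ 2 ∷ 0 ∷ 1 ∷ [])
  ∷ (8 ∷ 9 ∷ 10 ∷ 11 ∷ 5 ∷ 4 ∷ 7 ∷ 6 ∷ 0 ∷ 1 ∷ 2 ∷ 3 ∷ 14 ∷ 15 ∷ 12 ∷ 13 ∷ [] , 7 ∷ 6 ∷ 6 ∷ 5 ∷ 4 ∷ 5 ∷ 3 ∷ 4 ∷ 8 ∷ 7 ∷ 7 ∷ 6 ∷ 1 ∷ 0 ∷ 2 ∷ 1 ∷ [])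
  ∷ (8 ∷ 9 ∷ 10 ∷ 11 ∷ 5 ∷ 4 ∷ 14 ∷ 15 ∷ 0 ∷ 1 ∷ 2 ∷ 3 ∷ 13 ∷ 12 ∷ 6 ∷ 7 ∷ [] , 7 ∷ 6 ∷ 2 ∷ 1 ∷ 4 ∷ 5 ∷ 1 ∷ 0 ∷ 8 ∷ 7 ∷ 3 ∷ 2 ∷ 3 ∷ 4 ∷ 2 ∷ 1 ∷ [])
  ∷ (8 ∷ 9 ∷ 10 ∷ 11 ∷ 6 ∷ 7 ∷ 4 ∷ 5 ∷ 0 ∷ 1 ∷ 2 ∷ 3 ∷ 13 ∷ 12 ∷ 15 ∷ 14 ∷ [] , 7 ∷ 6 ∷ 6 ∷ 5 ∷ 4 ∷ 3 ∷ 5 ∷ 4 ∷ 8 ∷ 7 ∷ 7 ∷ 6 ∷ 1 ∷ 2 ∷ 0 ∷ 1 ∷ [])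
  ∷ (8 ∷ 9 ∷ 10 ∷ 11 ∷ 6 ∷ 7 ∷ 4 ∷ 5 ∷ 0 ∷ 1 ∷ 2 ∷ 3 ∷ 14 ∷ 15 ∷ 12 ∷ 13 ∷ [] , 5 ∷ 4 ∷ 4 ∷ 3 ∷ 2 ∷ 1 ∷ 3 ∷ 2 ∷ 6 ∷ 5 ∷ 5 ∷ 4 ∷ 1 ∷ 0 ∷ 2 ∷ 1 ∷ [])
  ∷ (8 ∷ 9 ∷ 10 ∷ 11 ∷ 6 ∷ 13 ∷ 4 ∷ 15 ∷ 0 ∷ 1 ∷ 2 ∷ 3 ∷ 14 ∷ 5 ∷ 12 ∷ 7 ∷ [] , 7 ∷ 2 ∷ 6 ∷ 1 ∷ 4 ∷ 1 ∷ 5 ∷ 0 ∷ 8 ∷ 3 ∷ 7 ∷ 2 ∷ 3 ∷ 2 ∷ 4 ∷ 1 ∷ [])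
  ∷ (8 ∷ 9 ∷ 10 ∷ 11 ∷ 12 ∷ 7 ∷ 14 ∷ 5 ∷ 0 ∷ 1 ∷ 2 ∷ 3 ∷ 4 ∷ 15 ∷ 6 ∷ 13 ∷ [] , 5 ∷ 4 ∷ 4 ∷ 3 ∷ 4 ∷ 1 ∷ 3 ∷ 2 ∷ 6 ∷ 5 ∷ 5 ∷ 4 ∷ 5 ∷ 0 ∷ 4 ∷ 1 ∷ [])
  ∷ (8 ∷ 9 ∷ 10 ∷ 11 ∷ 12 ∷ 13 ∷ 7 ∷ 6 ∷ 0 ∷ 1 ∷ 2 ∷ 3 ∷ 4 ∷ 5 ∷ 15 ∷ 14 ∷ [] , 5 ∷ 4 ∷ 4 ∷ 3 ∷ 4 ∷ 3 ∷ 1 ∷ 2 ∷ 6 ∷ 5 ∷ 5 ∷ 4 ∷ 5 ∷ 4 ∷ 0 ∷ 1 ∷ [])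
  ∷ (8 ∷ 9 ∷ 10 ∷ 11 ∷ 12 ∷ 13 ∷ 14 ∷ 15 ∷ 0 ∷ 1 ∷ 2 ∷ 3 ∷ 4 ∷ 5 ∷ 6 ∷ 7 ∷ [] , 3 ∷ 2 ∷ 2 ∷ 1 ∷ 2 ∷ 1 ∷ 1 ∷ 0 ∷ 4 ∷ 3 ∷ 3 ∷ 2 ∷ 3 ∷ 2 ∷ 2 ∷ 1 ∷ [])
  ∷ []

family₀ : Family 0 (Fin 1)
family₀ = tableFamily table₀
  (from-yes (all? (validTable? 0 ∘ lookup table₀)))
  (from-yes (graphsDistinct? 0 table₀))

family₁ : Family 1 (Fin 2)
family₁ = tableFamily table₁
  (from-yes (all? (validTable? 1 ∘ lookup table₁)))
  (from-yes (graphsDistinct? 1 table₁))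

family₂ : Family 2 (Fin 9)
family₂ = tableFamily table₂
  (from-yes (all? (validTable? 2 ∘ lookup table₂)))
  (from-yes (graphsDistinct? 2 table₂))

family₃ : Family 3 (Fin 256)
family₃ = tableFamily table₃
  (from-yes (all? (validTable? 3 ∘ lookup table₃)))
  (from-yes (graphsDistinct? 3 table₃))

splitFamily₄ : SplitFamily 4 (Fin 40824)
splitFamily₄ =
  gluePairs (subst (ComplementaryPairs 3 ∘ Fin) count (AllComplementaryPairs.complementaryPairs family₃))
  where
  count : List.length (AllComplementaryPairs.pairs family₃) ≡ 40824
  count = refl

membersPerVertex : ℕ → ℕ
membersPerVertex zero    = 40824
membersPerVertex (suc t) = (5 + t) * ((4 + t) * (membersPerVertex t * membersPerVertex t))

splitFamily : ∀ t → SplitFamily (4 + t) (Fin (membersPerVertex t))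
splitFamily zero    = splitFamily₄
splitFamily (suc t) = grow (splitFamily t)

r-bound : ∀ t → r (5 + t) ≤ ℕtoℚ ((5 + t) * membersPerVertex t)
r-bound zero    = from-yes (r 5 ≤? ℕtoℚ (5 * 40824))
r-bound (suc t) = r-step (2 + t) (membersPerVertex t) (r-bound t)

fromFamily : ∀ {n k} → r (suc n) ≤ ℕtoℚ k → Family n (Fin k) →
             Σ ℕ λ k → (r (suc n) ≤ ℕtoℚ k) × Σ (Fin k → PerfectMorseMatching n) PairwiseDifferent
fromFamily bound F = _ , bound , toPerfectMorseMatching ∘ Family.member F , pairwiseDifferent F

proposition15 : (n : ℕ) → Σ ℕ λ k → (r (suc n) ≤ ℕtoℚ k)
    × Σ (Fin k → PerfectMorseMatching n) PairwiseDifferent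
proposition15 0 = fromFamily (from-yes (r 1 ≤? ℕtoℚ 1)) family₀
proposition15 1 = fromFamily (from-yes (r 2 ≤? ℕtoℚ 2)) family₁
proposition15 2 = fromFamily (from-yes (r 3 ≤? ℕtoℚ 9)) family₂
proposition15 3 = fromFamily (from-yes (r 4 ≤? ℕtoℚ 256)) family₃
proposition15 (suc (suc (suc (suc t)))) = fromFamily (r-bound t) (splitFamily⇒family (splitFamily t))
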